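{- Linear boolean-width and total twin-width are functionally equivalent: there is a function $f:\mathbb N\to\mathbb N$ such that for every finite graph $G$, $\mathrm{ttww}(G)\le f(\mathrm{lboolw}(G))$ and $\mathrm{lboolw}(G)\le f(\mathrm{ttww}(G))$, where $\mathrm{lboolw}$ denotes linear boolean-width and $\mathrm{ttww}$ total twin-width.
   Context: Graphs are finite and simple. For a bipartition $(X,Y)$ of $V(G)$, $\mathrm{bool}(X,Y)$ is $\log_2$ of the number of distinct subsets of $Y$ of the form $N(S)\cap Y$ with $S\subseteq X$. A branch decomposition of $G$ is a tree whose internal nodes have degree 3 and whose leaves are in bijection with $V(G)$; each tree edge induces the bipartition of $V(G)$ given by the leaf sets of the two components after its removal. It is linear if its internal nodes form a path. The linear boolean-width of $G$ is the minimum over linear branch decompositions of the maximum of $\mathrm{bool}$ over the bipartitions induced by its edges. A partition sequence of an $n$-vertex graph $G$ is a sequence $\mathcal P_n,\dots,\mathcal P_1$ of partitions of $V(G)$ where $\mathcal P_n$ consists of singletons, $\mathcal P_1=\{V(G)\}$, and each $\mathcal P_i$ is obtained from $\mathcal P_{i+1}$ by merging two parts. Two disjoint vertex sets $X,Y$ are homogeneous if all or none of the pairs $x\in X$, $y\in Y$ are edges. For a partition $\mathcal P$, its red edges are the pairs of distinct non-homogeneous parts together with one red loop at each part having at least two vertices. The total twin-width $\mathrm{ttww}(G)$ is the minimum over partition sequences of the maximum over $i$ of the number of red edges (loops included) of $\mathcal P_i$. -}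

module Defs where

open import Data.Nat using (ℕ; zero; suc; _+_; _^_; _≤_; _<_; _≤ᵇ_)
open import Data.Bool using (Bool; true; false; _∧_; _∨_; not; if_then_else_)
open import Data.Bool.Properties using () renaming (_≟_ to _≟𝔹_)
open import Data.Fin using (Fin; zero; suc; toℕ)
open import Data.Fin.Properties using () renaming (_≟_ to _≟F_)
open import Data.Vec using (Vec; []; _∷_; tabulate; lookup; zipWith)
open import Data.Vec.Properties using (≡-dec)
open import Data.List using (List; []; _∷_; map; filterᵇ; length; deduplicate; _++_)
open import Data.Product using (Σ; _×_; _,_; proj₁)
open import Function.Definitions using (Injective; Surjective)
open import Relation.Binary.PropositionalEquality using (_≡_)
open import Relation.Nullary.Decidable using (⌊_⌋)

record Graph : Set where
  field
    n      : ℕ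
    adj    : Fin n → Fin n → Bool
    sym    : ∀ x y → adj x y ≡ adj y x
    irrefl : ∀ x → adj x x ≡ false
open Graph public

anyF : ∀ {n} → (Fin n → Bool) → Bool
anyF {zero}  f = false
anyF {suc n} f = f zero ∨ anyF (λ i → f (suc i))

sumF : ∀ {n} → (Fin n → ℕ) → ℕ
sumF {zero}  f = 0
sumF {suc n} f = f zero + sumF (λ i → f (suc i))

countF : ∀ {n} → (Fin n → Bool) → ℕ
countF f = sumF (λ i → if f i then 1 else 0)

VSet : ℕ → Set
VSet n = Vec Bool n

allSubsets : ∀ n → List (VSet n)
allSubsets zero    = [] ∷ []
allSubsets (suc n) = map (false ∷_) (allSubsets n) ++ map (true ∷_) (allSubsets n)

_⊆ᵇ_ : ∀ {n} → VSet n → VSet n → Bool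
_⊆ᵇ_ {n} S X = not (anyF (λ i → lookup S i ∧ not (lookup X i)))

_∩ᵛ_ : ∀ {n} → VSet n → VSet n → VSet n
S ∩ᵛ T = zipWith _∧_ S T

compl : ∀ {n} → VSet n → VSet n
compl S = tabulate (λ i → not (lookup S i))

nbhd : (G : Graph) → VSet (n G) → VSet (n G)
nbhd G S = tabulate (λ y → anyF (λ x → lookup S x ∧ adj G x y))

-- number of distinct sets N(S) ∩ Y with S ⊆ X  (bool(X,Y) = log₂ of this)
boolCount : (G : Graph) → VSet (n G) → VSet (n G) → ℕ
boolCount G X Y =
  length (deduplicate (≡-dec _≟𝔹_)
    (map (λ S → nbhd G S ∩ᵛ Y) (filterᵇ (λ S → S ⊆ᵇ X) (allSubsets (n G)))))

bool≤ : (G : Graph) → VSet (n G) → VSet (n G) → ℕ → Set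
bool≤ G X Y k = boolCount G X Y ≤ 2 ^ k

-- the unordered bipartition {X, V∖X} has bool ≤ k (both orientations)
cutBool≤ : (G : Graph) → VSet (n G) → ℕ → Set
cutBool≤ G X k = bool≤ G X (compl X) k × bool≤ G (compl X) X k

-- Linear branch decompositions (caterpillars), given by the left-to-right
-- order of the leaves: pos v = position of leaf v.  Bipartitions induced
-- by tree edges: leaf edges give ({v}, V∖{v}); spine/remaining edges give
-- (prefix of length i, rest) for 1 ≤ i < n.

singletonSet : ∀ {n} → Fin n → VSet n
singletonSet v = tabulate (λ u → ⌊ u ≟F v ⌋)

prefixSet : ∀ {n} → (Fin n → Fin n) → ℕ → VSet n
prefixSet pos i = tabulate (λ v → suc (toℕ (pos v)) ≤ᵇ i)

LinearDecomp : Graph → Set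
LinearDecomp G = Σ (Fin (n G) → Fin (n G)) Injective′
  where Injective′ = λ pos → Injective _≡_ _≡_ pos

decompWidth≤ : (G : Graph) → LinearDecomp G → ℕ → Set
decompWidth≤ G (pos , _) k =
  (∀ v → cutBool≤ G (singletonSet v) k) ×
  (∀ i → 1 ≤ i → i < n G → cutBool≤ G (prefixSet pos i) k)

lboolw≤ : Graph → ℕ → Set
lboolw≤ G k = Σ (LinearDecomp G) (λ L → decompWidth≤ G L k)

-- Total twin-width.  A partition of V(G) into exactly m parts is a
-- surjective labelling p : Fin n → Fin m (part a = p⁻¹(a)).

inPart : ∀ {n m} → (Fin n → Fin m) → Fin m → Fin n → Bool
inPart p a x = ⌊ p x ≟F a ⌋

nonHomogeneous : (G : Graph) {m : ℕ} → (Fin (n G) → Fin m) → Fin m → Fin m → Bool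
nonHomogeneous G p a b =
  anyF (λ x → anyF (λ y → inPart p a x ∧ inPart p b y ∧ adj G x y)) ∧
  anyF (λ x → anyF (λ y → inPart p a x ∧ inPart p b y ∧ not (adj G x y)))

-- red edges between distinct parts (unordered pairs) + red loops
redCount : (G : Graph) {m : ℕ} → (Fin (n G) → Fin m) → ℕ
redCount G p =
  sumF (λ a → countF (λ b → ((suc (toℕ a)) ≤ᵇ (toℕ b)) ∧ (nonHomogeneous G p a b)))
  + countF (λ a → (2 ≤ᵇ countF (inPart p a)))

-- A partition sequence P_n, …, P_1: P j has j+1 parts (for j < n);
-- P (j+1) refines P j, hence P j arises from P (j+1) by merging two parts.
-- P (n-1) has n parts, i.e. consists of singletons; P 0 = {V(G)}.
PartitionSeq : Graph → Set
PartitionSeq G =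
  Σ ((j : ℕ) → Fin (n G) → Fin (suc j)) λ P →
    (∀ j → j < n G → Surjective _≡_ _≡_ (P j)) ×
    (∀ j → suc j < n G → ∀ x y → P (suc j) x ≡ P (suc j) y → P j x ≡ P j y)

ttww≤ : Graph → ℕ → Set
ttww≤ G k = Σ (PartitionSeq G) λ S →
  ∀ j → j < n G → redCount G (proj₁ S j) ≤ k

-- Inside the
-- prefix X of length i, call two vertices equivalent when they have the same neighbours outside X;
-- distinct classes have distinct traces N(v) ∖ X, so there are at most 2^k classes.  Coarsening
-- "classes of X, singletons elsewhere" into the same partition for the next prefix one class at a
-- time yields a partition sequence.  In each of its partitions, every nontrivial part lies inside
-- the next prefix X′ and consists of twins with respect to V ∖ X′, so red edges only join the at
-- most 2^k + 1 parts meeting X′: at most M² + M red edges for M = 2^k + 1.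
--
-- Order the vertices by decreasing level at
-- which they become singletons of the partition sequence.  A prefix of this order is the set B of
-- vertices in nontrivial parts of some P_j, plus at most two vertices that joined a nontrivial part
-- in the merge producing P_(j-1).  In P_j at most 2k singletons carry a red edge, and each other
-- singleton is homogeneous to all of the at most k nontrivial parts, so bool(B, V ∖ B) ≤ 2k + k;
-- the two extra vertices add at most 2.

module Submission where

open import Defs hiding (sym)
open import Algebra.Properties.CommutativeSemigroup using (interchange)
open import Data.Bool using (Bool; true; false; _∧_; _∨_; not; if_then_else_; T; T?)
open import Data.Bool.Properties using (∧-zeroʳ; ∧-identityʳ) renaming (_≟_ to _≟𝔹_)
open import Data.Empty using (⊥; ⊥-elim)
open import Data.Fin using (Fin; zero; suc; toℕ; fromℕ<)
open import Data.Fin.Properties using (toℕ<n; toℕ-fromℕ<; toℕ-injective) renaming (_≟_ to _≟F_; suc-injective to Fin-suc-injective)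
open import Data.List using (List; []; _∷_; length; map; filter; filterᵇ; deduplicate; cartesianProductWith; allFin; _++_)
open import Data.List.Membership.Propositional using (_∈_)
open import Data.List.Membership.Propositional.Properties
open import Data.List.Properties using (filter-notAll; length-map; length-++; length-tabulate)
open import Data.List.Relation.Binary.Subset.Propositional using (_⊆_)
open import Data.List.Relation.Unary.All using (All; []; _∷_)
import Data.List.Relation.Unary.All as All
import Data.List.Relation.Unary.All.Properties as All
open import Data.List.Relation.Unary.AllPairs using ([]; _∷_)
open import Data.List.Relation.Unary.Any using (here; there)
import Data.List.Relation.Unary.Any as Any
open import Data.List.Relation.Unary.Unique.Propositional using (Unique)
open import Data.List.Relation.Unary.Unique.Propositional.Properties using (allFin⁺)
open import Data.List.Relation.Unary.Unique.DecPropositional.Properties using (deduplicate-!)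
open import Data.Nat using (ℕ; zero; suc; _+_; _∸_; _*_; _^_; _≤_; _<_; z≤n; s≤s; _≤ᵇ_; _<ᵇ_; _≟_; _≤?_; _<?_)
open import Data.Nat.Properties
open import Data.Product using (Σ; ∃; ∃₂; _×_; _,_; proj₁; proj₂)
open import Data.Sum using (_⊎_; inj₁; inj₂)
open import Data.Unit using (tt)
open import Data.Vec using ([]; _∷_; tabulate; lookup; zipWith; replicate)
open import Data.Vec.Properties using (≡-dec; lookup∘tabulate; tabulate∘lookup; tabulate-cong; lookup-zipWith; lookup-replicate)
open import Function using (_∘_; id)
open import Relation.Binary.Definitions using (DecidableEquality; tri<; tri≈; tri>)
open import Relation.Binary.PropositionalEquality
open import Relation.Nullary using (Dec; yes; no; ¬_; ¬?)
open import Relation.Nullary.Decidable using (⌊_⌋; _⊎-dec_; _×-dec_)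

module _ {A : Set} (_≟A_ : DecidableEquality A) where

  unique-⊆⇒length≤ : ∀ {xs ys : List A} → Unique xs → xs ⊆ ys → length xs ≤ length ys
  unique-⊆⇒length≤ {[]} _ _ = z≤n
  unique-⊆⇒length≤ {x ∷ xs} {ys} (x∉xs ∷ u) xs⊆ys =
    ≤-trans (s≤s (unique-⊆⇒length≤ u xs⊆ys∖x))
            (filter-notAll (λ z → ¬? (x ≟A z)) ys (Any.map (λ { refl x≢x → x≢x refl }) (xs⊆ys (here refl))))
    where
    xs⊆ys∖x : xs ⊆ filter (λ z → ¬? (x ≟A z)) ys
    xs⊆ys∖x z∈ = ∈-filter⁺ (λ z → ¬? (x ≟A z)) (xs⊆ys (there z∈)) (All.lookup x∉xs z∈)

  distinctCount : List A → ℕ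
  distinctCount xs = length (deduplicate _≟A_ xs)

  distinctCount-mono : ∀ {xs ys} → xs ⊆ ys → distinctCount xs ≤ distinctCount ys
  distinctCount-mono xs⊆ys = unique-⊆⇒length≤ (deduplicate-! _≟A_ _) (∈-deduplicate⁺ _≟A_ ∘ xs⊆ys ∘ ∈-deduplicate⁻ _≟A_ _)

  distinctCount≤length : ∀ {xs ys} → xs ⊆ ys → distinctCount xs ≤ length ys
  distinctCount≤length {xs} xs⊆ys = unique-⊆⇒length≤ (deduplicate-! _≟A_ xs) (xs⊆ys ∘ ∈-deduplicate⁻ _≟A_ _)

  unique⇒length≤distinctCount : ∀ {us xs} → Unique us → us ⊆ xs → length us ≤ distinctCount xs
  unique⇒length≤distinctCount u us⊆xs = unique-⊆⇒length≤ u (∈-deduplicate⁺ _≟A_ ∘ us⊆xs)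

  distinctCount≤suc : ∀ (c : A) {xs ys : List A} → (∀ {z} → z ∈ xs → z ≡ c ⊎ z ∈ ys) → distinctCount xs ≤ suc (distinctCount ys)
  distinctCount≤suc c {xs} {ys} h = distinctCount≤length xs⊆c∷ys
    where
    xs⊆c∷ys : xs ⊆ (c ∷ deduplicate _≟A_ ys)
    xs⊆c∷ys z∈ with h z∈
    ... | inj₁ refl = here refl
    ... | inj₂ z∈ys = there (∈-deduplicate⁺ _≟A_ z∈ys)

  distinctCount≤2 : ∀ {xs : List A} (a b : A) → (∀ {z} → z ∈ xs → z ≡ a ⊎ z ≡ b) → distinctCount xs ≤ 2
  distinctCount≤2 {xs} a b h = distinctCount≤length {xs = xs} {ys = a ∷ b ∷ []} xs⊆ab
    where
    xs⊆ab : xs ⊆ (a ∷ b ∷ [])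
    xs⊆ab z∈ with h z∈
    ... | inj₁ refl = here refl
    ... | inj₂ refl = there (here refl)

length-cartesianProductWith : {A B C : Set} (f : A → B → C) (xs : List A) (ys : List B) →
                              length (cartesianProductWith f xs ys) ≡ length xs * length ys
length-cartesianProductWith f [] ys = refl
length-cartesianProductWith f (x ∷ xs) ys =
  trans (length-++ (map (f x) ys)) (cong₂ _+_ (length-map (f x) ys) (length-cartesianProductWith f xs ys))

module _ {A C : Set} (_≟A_ : DecidableEquality A) (_≟C_ : DecidableEquality C) where

  distinctCount-image : ∀ (f : A → C) {xs : List C} {ys : List A} →
                        (∀ {z} → z ∈ xs → ∃ λ a → a ∈ ys × z ≡ f a) → distinctCount _≟C_ xs ≤ distinctCount _≟A_ ys
  distinctCount-image f {xs} {ys} h = ≤-trans (distinctCount≤length _≟C_ xs⊆image) (≤-reflexive (length-map f (deduplicate _≟A_ ys)))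
    where
    xs⊆image : xs ⊆ map f (deduplicate _≟A_ ys)
    xs⊆image z∈ with h z∈
    ... | a , a∈ , refl = ∈-map⁺ f (∈-deduplicate⁺ _≟A_ a∈)

module _ {A B C : Set} (_≟A_ : DecidableEquality A) (_≟B_ : DecidableEquality B) (_≟C_ : DecidableEquality C) where

  distinctCount-image₂ : ∀ (f : A → B → C) {xs : List C} {ys : List A} {zs : List B} →
                         (∀ {z} → z ∈ xs → ∃₂ λ a b → a ∈ ys × b ∈ zs × z ≡ f a b) →
                         distinctCount _≟C_ xs ≤ distinctCount _≟A_ ys * distinctCount _≟B_ zs
  distinctCount-image₂ f {xs} {ys} {zs} h =
    ≤-trans (distinctCount≤length _≟C_ xs⊆image)
            (≤-reflexive (length-cartesianProductWith f (deduplicate _≟A_ ys) (deduplicate _≟B_ zs)))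
    where
    xs⊆image : xs ⊆ cartesianProductWith f (deduplicate _≟A_ ys) (deduplicate _≟B_ zs)
    xs⊆image z∈ with h z∈
    ... | a , b , a∈ , b∈ , refl = ∈-cartesianProductWith⁺ f (∈-deduplicate⁺ _≟A_ a∈) (∈-deduplicate⁺ _≟B_ b∈)

module _ {A C : Set} (_≟C_ : DecidableEquality C) (key : A → C) where

  findByKey : C → List A → A → A
  findByKey c [] default = default
  findByKey c (x ∷ xs) default with key x ≟C c
  ... | yes _ = x
  ... | no _ = findByKey c xs default

  findByKey-spec : ∀ {x xs} default → x ∈ xs →
                   findByKey (key x) xs default ∈ xs × key (findByKey (key x) xs default) ≡ key x
  findByKey-spec {x} {y ∷ xs} default x∈ with key y ≟C key x
  ... | yes e = here refl , e
  findByKey-spec {x} {y ∷ xs} default (here refl) | no ne = ⊥-elim (ne refl)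
  findByKey-spec {x} {y ∷ xs} default (there x∈) | no ne with findByKey-spec default x∈
  ... | found∈ , keyEq = there found∈ , keyEq

  distinctCount-factor : ∀ {B : Set} (_≟B_ : DecidableEquality B) (p : A → B) (xs : List A) →
                         (∀ {x y} → x ∈ xs → y ∈ xs → key x ≡ key y → p x ≡ p y) →
                         distinctCount _≟B_ (map p xs) ≤ distinctCount _≟C_ (map key xs)
  distinctCount-factor _≟B_ p [] h = z≤n
  distinctCount-factor _≟B_ p (x₀ ∷ xs) h =
    distinctCount-image _≟C_ _≟B_ (p ∘ λ c → findByKey c (x₀ ∷ xs) x₀) {xs = map p (x₀ ∷ xs)} {ys = map key (x₀ ∷ xs)} witness
    where
    witness : ∀ {z} → z ∈ map p (x₀ ∷ xs) → ∃ λ c → c ∈ map key (x₀ ∷ xs) × z ≡ p (findByKey c (x₀ ∷ xs) x₀)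
    witness z∈ with ∈-map⁻ p z∈
    ... | x , x∈ , refl with findByKey-spec x₀ x∈
    ... | found∈ , keyEq = key x , ∈-map⁺ key x∈ , h x∈ found∈ (sym keyEq)

true≢false : true ≡ false → ⊥
true≢false ()

bool-ext : ∀ {a b : Bool} → (a ≡ true → b ≡ true) → (b ≡ true → a ≡ true) → a ≡ b
bool-ext {false} {false} _ _ = refl
bool-ext {false} {true} _ b⇒a = b⇒a refl
bool-ext {true} {false} a⇒b _ = sym (a⇒b refl)
bool-ext {true} {true} _ _ = refl

false⊎true : ∀ (a : Bool) → a ≡ false ⊎ a ≡ true
false⊎true false = inj₁ refl
false⊎true true = inj₂ refl

∧-true⁻ : ∀ {a b} → a ∧ b ≡ true → a ≡ true × b ≡ true
∧-true⁻ {true} {true} _ = refl , refl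

∧-true⁺ : ∀ {a b} → a ≡ true → b ≡ true → a ∧ b ≡ true
∧-true⁺ refl refl = refl

∨-true⁻ : ∀ {a b} → a ∨ b ≡ true → a ≡ true ⊎ b ≡ true
∨-true⁻ {true} _ = inj₁ refl
∨-true⁻ {false} e = inj₂ e

∨-trueˡ : ∀ {a b} → a ≡ true → a ∨ b ≡ true
∨-trueˡ refl = refl

∨-trueʳ : ∀ {a b} → b ≡ true → a ∨ b ≡ true
∨-trueʳ {true} _ = refl
∨-trueʳ {false} e = e

∨-false⁻ : ∀ {a b} → a ∨ b ≡ false → a ≡ false × b ≡ false
∨-false⁻ {false} {false} _ = refl , refl

not≡true⇒false : ∀ {a} → not a ≡ true → a ≡ false
not≡true⇒false {false} _ = refl

false⇒not≡true : ∀ {a} → a ≡ false → not a ≡ true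
false⇒not≡true refl = refl

T⇒≡true : ∀ {b} → T b → b ≡ true
T⇒≡true {true} _ = refl

≡true⇒T : ∀ {b} → b ≡ true → T b
≡true⇒T refl = tt

⌊⌋-true⁺ : ∀ {P : Set} (d : Dec P) → P → ⌊ d ⌋ ≡ true
⌊⌋-true⁺ (yes _) _ = refl
⌊⌋-true⁺ (no ¬p) p = ⊥-elim (¬p p)

⌊⌋-true⁻ : ∀ {P : Set} (d : Dec P) → ⌊ d ⌋ ≡ true → P
⌊⌋-true⁻ (yes p) _ = p

⌊⌋-false⁺ : ∀ {P : Set} (d : Dec P) → ¬ P → ⌊ d ⌋ ≡ false
⌊⌋-false⁺ (yes p) ¬p = ⊥-elim (¬p p)
⌊⌋-false⁺ (no _) _ = refl

≤ᵇ-true⁺ : ∀ {a b} → a ≤ b → (a ≤ᵇ b) ≡ true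
≤ᵇ-true⁺ le = T⇒≡true (≤⇒≤ᵇ le)

≤ᵇ-true⁻ : ∀ {a b} → (a ≤ᵇ b) ≡ true → a ≤ b
≤ᵇ-true⁻ {a} {b} e = ≤ᵇ⇒≤ a b (≡true⇒T e)

<ᵇ-true⁺ : ∀ {a b} → a < b → (a <ᵇ b) ≡ true
<ᵇ-true⁺ l = T⇒≡true (<⇒<ᵇ l)

<ᵇ-true⁻ : ∀ {a b} → (a <ᵇ b) ≡ true → a < b
<ᵇ-true⁻ {a} {b} e = <ᵇ⇒< a b (≡true⇒T e)

<ᵇ-false⁺ : ∀ {a b} → ¬ a < b → (a <ᵇ b) ≡ false
<ᵇ-false⁺ {a} {b} a≮b with false⊎true (a <ᵇ b)
... | inj₁ e = e
... | inj₂ e = ⊥-elim (a≮b (<ᵇ-true⁻ e))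

if-≤ : ∀ {x} b → (b ≡ true → x ≤ 2) → (b ≡ false → x ≤ 1) → x ≤ (if b then 2 else 1)
if-≤ true ≤2 _ = ≤2 refl
if-≤ false _ ≤1 = ≤1 refl

anyF-true⁻ : ∀ {n} (f : Fin n → Bool) → anyF f ≡ true → ∃ λ i → f i ≡ true
anyF-true⁻ {suc n} f e with ∨-true⁻ {f zero} e
... | inj₁ e₀ = zero , e₀
... | inj₂ e₁ with anyF-true⁻ (f ∘ suc) e₁
... | i , eᵢ = suc i , eᵢ

anyF-true⁺ : ∀ {n} (f : Fin n → Bool) i → f i ≡ true → anyF f ≡ true
anyF-true⁺ f zero e = ∨-trueˡ e
anyF-true⁺ f (suc i) e = ∨-trueʳ {f zero} (anyF-true⁺ (f ∘ suc) i e)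

anyF-false⁺ : ∀ {n} (f : Fin n → Bool) → (∀ i → f i ≡ false) → anyF f ≡ false
anyF-false⁺ f h = bool-ext (λ e → let (i , eᵢ) = anyF-true⁻ f e in trans (sym (h i)) eᵢ) (λ ())

anyF-false⁻ : ∀ {n} (f : Fin n → Bool) → anyF f ≡ false → ∀ i → f i ≡ false
anyF-false⁻ f e i with false⊎true (f i)
... | inj₁ fᵢ = fᵢ
... | inj₂ fᵢ = ⊥-elim (true≢false (trans (sym (anyF-true⁺ f i fᵢ)) e))

anyF-mono : ∀ {n} (f g : Fin n → Bool) → (∀ x → f x ≡ true → g x ≡ true) → anyF f ≡ true → anyF g ≡ true
anyF-mono f g h e with anyF-true⁻ f e
... | x , fx = anyF-true⁺ g x (h x fx)

anyF-cong : ∀ {n} {f g : Fin n → Bool} → (∀ i → f i ≡ g i) → anyF f ≡ anyF g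
anyF-cong {zero} h = refl
anyF-cong {suc n} h = cong₂ _∨_ (h zero) (anyF-cong (h ∘ suc))

anyF-swap : ∀ {m m′} (h : Fin m → Fin m′ → Bool) → anyF (λ x → anyF (λ y → h x y)) ≡ anyF (λ y → anyF (λ x → h x y))
anyF-swap h = bool-ext
  (λ e → let (x , ex) = anyF-true⁻ (λ x → anyF (λ y → h x y)) e ; (y , exy) = anyF-true⁻ (h x) ex in
     anyF-true⁺ (λ y → anyF (λ x → h x y)) y (anyF-true⁺ (λ x → h x y) x exy))
  (λ e → let (y , ey) = anyF-true⁻ (λ y → anyF (λ x → h x y)) e ; (x , exy) = anyF-true⁻ (λ x → h x y) ey in
     anyF-true⁺ (λ x → anyF (λ y → h x y)) x (anyF-true⁺ (h x) y exy))

sumF-cong : ∀ {n} {f g : Fin n → ℕ} → (∀ i → f i ≡ g i) → sumF f ≡ sumF g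
sumF-cong {zero} h = refl
sumF-cong {suc n} h = cong₂ _+_ (h zero) (sumF-cong (h ∘ suc))

sumF-mono : ∀ {n} {f g : Fin n → ℕ} → (∀ i → f i ≤ g i) → sumF f ≤ sumF g
sumF-mono {zero} h = z≤n
sumF-mono {suc n} h = +-mono-≤ (h zero) (sumF-mono (h ∘ suc))

sumF-strict : ∀ {n} {f g : Fin n → ℕ} → (∀ i → f i ≤ g i) → (i : Fin n) → f i < g i → sumF f < sumF g
sumF-strict {suc n} h zero lt = +-mono-<-≤ lt (sumF-mono (h ∘ suc))
sumF-strict {suc n} h (suc i) lt = +-mono-≤-< (h zero) (sumF-strict (h ∘ suc) i lt)

sumF-+ : ∀ {n} (f g : Fin n → ℕ) → sumF (λ i → f i + g i) ≡ sumF f + sumF g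
sumF-+ {zero} f g = refl
sumF-+ {suc n} f g = trans (cong (f zero + g zero +_) (sumF-+ (f ∘ suc) (g ∘ suc)))
                           (interchange +-commutativeSemigroup (f zero) (g zero) (sumF (f ∘ suc)) (sumF (g ∘ suc)))

sumF-zero : ∀ {n} (f : Fin n → ℕ) → (∀ i → f i ≡ 0) → sumF f ≡ 0
sumF-zero {zero} f h = refl
sumF-zero {suc n} f h = cong₂ _+_ (h zero) (sumF-zero (f ∘ suc) (h ∘ suc))

sumF-swap : ∀ {n m} (h : Fin n → Fin m → ℕ) → sumF (λ i → sumF (λ j → h i j)) ≡ sumF (λ j → sumF (λ i → h i j))
sumF-swap {zero} {m} h = sym (sumF-zero {m} (λ j → 0) (λ j → refl))
sumF-swap {suc n} {m} h = trans (cong (sumF (h zero) +_) (sumF-swap (h ∘ suc)))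
  (sym (sumF-+ (λ j → h zero j) (λ j → sumF (λ i → h (suc i) j))))

sumF≤countF* : ∀ {m} (g : Fin m → ℕ) (f : Fin m → Bool) M → (∀ a → g a ≤ (if f a then M else 0)) → sumF g ≤ countF f * M
sumF≤countF* {zero} g f M h = z≤n
sumF≤countF* {suc m} g f M h with f zero | h zero
... | true | h₀ = +-mono-≤ h₀ (sumF≤countF* (g ∘ suc) (f ∘ suc) M (h ∘ suc))
... | false | h₀ = +-mono-≤ h₀ (sumF≤countF* (g ∘ suc) (f ∘ suc) M (h ∘ suc))

prodF : ∀ {m} → (Fin m → ℕ) → ℕ
prodF {zero} f = 1
prodF {suc m} f = f zero * prodF (f ∘ suc)

prodF≤2^countF : ∀ {m} (f : Fin m → ℕ) (g : Fin m → Bool) → (∀ a → f a ≤ (if g a then 2 else 1)) → prodF f ≤ 2 ^ countF g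
prodF≤2^countF {zero} f g h = ≤-refl
prodF≤2^countF {suc m} f g h with g zero | h zero
... | true | h₀ = *-mono-≤ h₀ (prodF≤2^countF (f ∘ suc) (g ∘ suc) (h ∘ suc))
... | false | h₀ = ≤-trans (*-mono-≤ h₀ (prodF≤2^countF (f ∘ suc) (g ∘ suc) (h ∘ suc))) (≤-reflexive (+-identityʳ _))

indicator : Bool → ℕ
indicator b = if b then 1 else 0

indicator-mono : ∀ {a b} → (a ≡ true → b ≡ true) → indicator a ≤ indicator b
indicator-mono {false} h = z≤n
indicator-mono {true} h rewrite h refl = ≤-refl

indicator-∨ : ∀ a b → indicator (a ∨ b) ≤ indicator a + indicator b
indicator-∨ false b = ≤-refl
indicator-∨ true b = s≤s z≤n

countF-mono : ∀ {n} {f g : Fin n → Bool} → (∀ i → f i ≡ true → g i ≡ true) → countF f ≤ countF g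
countF-mono h = sumF-mono (λ i → indicator-mono (h i))

countF-cong : ∀ {n} {f g : Fin n → Bool} → (∀ i → f i ≡ g i) → countF f ≡ countF g
countF-cong h = sumF-cong (λ i → cong indicator (h i))

countF-strict : ∀ {n} {f g : Fin n → Bool} → (∀ i → f i ≡ true → g i ≡ true) →
                (i : Fin n) → f i ≡ false → g i ≡ true → countF f < countF g
countF-strict h i fᵢ gᵢ =
  sumF-strict (λ j → indicator-mono (h j)) i (subst₂ (λ a b → indicator a < indicator b) (sym fᵢ) (sym gᵢ) (s≤s z≤n))

countF-pos : ∀ {n} (f : Fin n → Bool) (i : Fin n) → f i ≡ true → 1 ≤ countF f
countF-pos f i fᵢ = ≤-trans (s≤s z≤n) (countF-strict {f = λ _ → false} {g = f} (λ _ ()) i refl fᵢ)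

countF-zero : ∀ {n} (f : Fin n → Bool) → (∀ i → f i ≡ false) → countF f ≡ 0
countF-zero f h = sumF-zero _ (λ i → cong indicator (h i))

countF-true : ∀ n → countF (λ (_ : Fin n) → true) ≡ n
countF-true zero = refl
countF-true (suc n) = cong suc (countF-true n)

countF-∨ : ∀ {n} (f g : Fin n → Bool) → countF (λ i → f i ∨ g i) ≤ countF f + countF g
countF-∨ f g = ≤-trans (sumF-mono (λ i → indicator-∨ (f i) (g i))) (≤-reflexive (sumF-+ (indicator ∘ f) (indicator ∘ g)))

indicator-anyF : ∀ {m} (h : Fin m → Bool) → indicator (anyF h) ≤ countF h
indicator-anyF h with false⊎true (anyF h)
... | inj₁ e rewrite e = z≤n
... | inj₂ e rewrite e = let (i , eᵢ) = anyF-true⁻ h e in countF-pos h i eᵢ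

countF-anyF : ∀ {n m} (h : Fin n → Fin m → Bool) → countF (λ b → anyF (h b)) ≤ sumF (λ b → countF (h b))
countF-anyF h = sumF-mono (λ b → indicator-anyF (h b))

countF-<ᵇ : ∀ n c → c ≤ n → countF {n} (λ i → toℕ i <ᵇ c) ≡ c
countF-<ᵇ zero zero z≤n = refl
countF-<ᵇ (suc n) zero _ = countF-zero {suc n} (λ i → toℕ i <ᵇ 0) (λ i → refl)
countF-<ᵇ (suc n) (suc c) (s≤s c≤n) = cong suc (countF-<ᵇ n c c≤n)

trueIndices : ∀ {n} → (Fin n → Bool) → List (Fin n)
trueIndices {zero} f = []
trueIndices {suc n} f with f zero
... | true = zero ∷ map suc (trueIndices (f ∘ suc))
... | false = map suc (trueIndices (f ∘ suc))

length-trueIndices : ∀ {n} (f : Fin n → Bool) → length (trueIndices f) ≡ countF f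
length-trueIndices {zero} f = refl
length-trueIndices {suc n} f with f zero
... | true = cong suc (trans (length-map suc (trueIndices (f ∘ suc))) (length-trueIndices (f ∘ suc)))
... | false = trans (length-map suc (trueIndices (f ∘ suc))) (length-trueIndices (f ∘ suc))

∈-trueIndices⁺ : ∀ {n} (f : Fin n → Bool) i → f i ≡ true → i ∈ trueIndices f
∈-trueIndices⁺ {suc n} f i fᵢ with f zero in e₀
∈-trueIndices⁺ {suc n} f zero fᵢ | true = here refl
∈-trueIndices⁺ {suc n} f (suc i) fᵢ | true = there (∈-map⁺ suc (∈-trueIndices⁺ (f ∘ suc) i fᵢ))
∈-trueIndices⁺ {suc n} f zero fᵢ | false = ⊥-elim (true≢false (trans (sym fᵢ) e₀))
∈-trueIndices⁺ {suc n} f (suc i) fᵢ | false = ∈-map⁺ suc (∈-trueIndices⁺ (f ∘ suc) i fᵢ)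

∈-trueIndices⁻ : ∀ {n} (f : Fin n → Bool) i → i ∈ trueIndices f → f i ≡ true
∈-trueIndices⁻ {suc n} f i i∈ with f zero in e₀
∈-trueIndices⁻ {suc n} f i (here refl) | true = e₀
∈-trueIndices⁻ {suc n} f i (there i∈) | true with ∈-map⁻ suc i∈
... | j , j∈ , refl = ∈-trueIndices⁻ (f ∘ suc) j j∈
∈-trueIndices⁻ {suc n} f i i∈ | false with ∈-map⁻ suc i∈
... | j , j∈ , refl = ∈-trueIndices⁻ (f ∘ suc) j j∈

map-Unique-injectiveOn : ∀ {A B : Set} (e : A → B) (xs : List A) → Unique xs →
                         (∀ {x y} → x ∈ xs → y ∈ xs → e x ≡ e y → x ≡ y) → Unique (map e xs)
map-Unique-injectiveOn e [] _ _ = []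
map-Unique-injectiveOn e (x ∷ xs) (x∉xs ∷ u) inj =
  fresh xs x∉xs (λ y∈ → inj (here refl) (there y∈)) ∷ map-Unique-injectiveOn e xs u (λ a b → inj (there a) (there b))
  where
  fresh : ∀ ys → All (λ y → ¬ x ≡ y) ys → (∀ {y} → y ∈ ys → e x ≡ e y → x ≡ y) → All (λ z → ¬ e x ≡ z) (map e ys)
  fresh [] _ _ = []
  fresh (y ∷ ys) (x≢y ∷ x∉ys) h = (λ ex≡ey → x≢y (h (here refl) ex≡ey)) ∷ fresh ys x∉ys (h ∘ there)

Unique-trueIndices : ∀ {n} (f : Fin n → Bool) → Unique (trueIndices f)
Unique-trueIndices {zero} f = []
Unique-trueIndices {suc n} f with f zero
... | true = zero∉ (trueIndices (f ∘ suc)) ∷ sucs-unique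
  where
  zero∉ : ∀ (xs : List (Fin n)) → All (λ y → ¬ zero ≡ y) (map suc xs)
  zero∉ [] = []
  zero∉ (x ∷ xs) = (λ ()) ∷ zero∉ xs
  sucs-unique = map-Unique-injectiveOn suc _ (Unique-trueIndices (f ∘ suc)) (λ _ _ → Fin-suc-injective)
... | false = map-Unique-injectiveOn suc _ (Unique-trueIndices (f ∘ suc)) (λ _ _ → Fin-suc-injective)

unique⇒length≤countF : ∀ {n} (f : Fin n → Bool) (us : List (Fin n)) → Unique us → (∀ {u} → u ∈ us → f u ≡ true) → length us ≤ countF f
unique⇒length≤countF {n} f us u h =
  ≤-trans (unique-⊆⇒length≤ (_≟F_ {n}) u (λ u∈ → ∈-trueIndices⁺ f _ (h u∈))) (≤-reflexive (length-trueIndices f))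

countF-injection : ∀ {n m} (f : Fin n → Bool) (g : Fin m → Bool) (e : Fin n → Fin m) →
                   (∀ x y → f x ≡ true → f y ≡ true → e x ≡ e y → x ≡ y) → (∀ x → f x ≡ true → g (e x) ≡ true) →
                   countF f ≤ countF g
countF-injection f g e inj h = begin
  countF f                          ≡⟨ sym (length-trueIndices f) ⟩
  length (trueIndices f)            ≡⟨ sym (length-map e (trueIndices f)) ⟩
  length (map e (trueIndices f))    ≤⟨ unique⇒length≤countF g (map e (trueIndices f)) image-unique image-true ⟩
  countF g                          ∎
  where
  open ≤-Reasoning
  image-unique = map-Unique-injectiveOn e (trueIndices f) (Unique-trueIndices f)
                   (λ a b → inj _ _ (∈-trueIndices⁻ f _ a) (∈-trueIndices⁻ f _ b))
  image-true : ∀ {u} → u ∈ map e (trueIndices f) → g u ≡ true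
  image-true u∈ with ∈-map⁻ e u∈
  ... | x , x∈ , refl = h x (∈-trueIndices⁻ f x x∈)

countF≥2 : ∀ {n} (f : Fin n → Bool) x y → f x ≡ true → f y ≡ true → ¬ x ≡ y → 2 ≤ countF f
countF≥2 f x y fx fy x≢y = unique⇒length≤countF f (x ∷ y ∷ []) ((x≢y ∷ []) ∷ [] ∷ []) both
  where
  both : ∀ {u} → u ∈ x ∷ y ∷ [] → f u ≡ true
  both (here refl) = fx
  both (there (here refl)) = fy

countF≥1⇒witness : ∀ {n} (f : Fin n → Bool) → 1 ≤ countF f → ∃ λ u → f u ≡ true
countF≥1⇒witness f le with trueIndices f | length-trueIndices f | ∈-trueIndices⁻ f
... | [] | eq | _ = ⊥-elim (<⇒≱ le (≤-reflexive (sym eq)))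
... | x ∷ _ | _ | mem = x , mem x (here refl)

countF≥2⇒other : ∀ {n} (f : Fin n → Bool) u → 2 ≤ countF f → ∃ λ w → ¬ w ≡ u × f w ≡ true
countF≥2⇒other f u le with trueIndices f | length-trueIndices f | Unique-trueIndices f | ∈-trueIndices⁻ f
... | [] | eq | _ | _ = ⊥-elim (<⇒≱ le (≤-trans (≤-reflexive (sym eq)) z≤n))
... | x ∷ [] | eq | _ | _ = ⊥-elim (<⇒≱ le (≤-reflexive (sym eq)))
... | x ∷ y ∷ _ | _ | (x∉ ∷ _) | mem with x ≟F u
...   | yes refl = y , (λ y≡x → All.head x∉ (sym y≡x)) , mem y (there (here refl))
...   | no x≢u = x , x≢u , mem x (here refl)

countF≥3⇒three : ∀ {n} (f : Fin n → Bool) → 3 ≤ countF f →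
                 ∃ λ u₁ → ∃ λ u₂ → ∃ λ u₃ → f u₁ ≡ true × f u₂ ≡ true × f u₃ ≡ true × ¬ u₁ ≡ u₂ × ¬ u₁ ≡ u₃ × ¬ u₂ ≡ u₃
countF≥3⇒three f le with trueIndices f | length-trueIndices f | Unique-trueIndices f | ∈-trueIndices⁻ f
... | [] | eq | _ | _ = ⊥-elim (<⇒≱ le (≤-trans (≤-reflexive (sym eq)) z≤n))
... | x ∷ [] | eq | _ | _ = ⊥-elim (<⇒≱ le (≤-trans (≤-reflexive (sym eq)) (s≤s z≤n)))
... | x ∷ y ∷ [] | eq | _ | _ = ⊥-elim (<⇒≱ le (≤-reflexive (sym eq)))
... | x ∷ y ∷ z ∷ _ | _ | ((x≢y ∷ x≢z ∷ _) ∷ (y≢z ∷ _) ∷ _) | mem =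
  x , y , z , mem x (here refl) , mem y (there (here refl)) , mem z (there (there (here refl))) , x≢y , x≢z , y≢z

countF≤1 : ∀ {n} (f : Fin n → Bool) → (∀ x y → f x ≡ true → f y ≡ true → x ≡ y) → countF f ≤ 1
countF≤1 f at-most-one with 2 ≤? countF f
... | no ¬2≤ = ≤-pred (≰⇒> ¬2≤)
... | yes 2≤ with countF≥1⇒witness f (≤-trans (s≤s z≤n) 2≤)
... | u , fu with countF≥2⇒other f u 2≤
... | w , w≢u , fw = ⊥-elim (w≢u (at-most-one w u fw fu))

countF-toℕ≡ : ∀ {N} s → countF (λ (r : Fin N) → ⌊ toℕ r ≟ s ⌋) ≤ 1
countF-toℕ≡ {N} s = countF≤1 (λ (r : Fin N) → ⌊ toℕ r ≟ s ⌋)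
  (λ x y ex ey → toℕ-injective (trans (⌊⌋-true⁻ (toℕ x ≟ s) ex) (sym (⌊⌋-true⁻ (toℕ y ≟ s) ey))))

module _ {M : ℕ} {B : Set} (_≟B_ : DecidableEquality B) (g : Fin M → B) where

  imageSize : ℕ
  imageSize = distinctCount _≟B_ (map g (allFin M))

  injection-into-image⇒≤imageSize : ∀ {M′} (e : Fin M′ → B) → (∀ b → ∃ λ x → g x ≡ e b) → (∀ a b → e a ≡ e b → a ≡ b) → M′ ≤ imageSize
  injection-into-image⇒≤imageSize {M′} e into inj =
    ≤-trans (≤-reflexive (sym (trans (length-map e (allFin M′)) (length-tabulate id))))
            (unique⇒length≤distinctCount _≟B_ (map-Unique-injectiveOn e (allFin M′) (allFin⁺ M′) (λ _ _ → inj _ _)) e⊆g)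
    where
    e⊆g : map e (allFin M′) ⊆ map g (allFin M)
    e⊆g z∈ with ∈-map⁻ e z∈
    ... | b , _ , refl = let (x , gx) = into b in subst (_∈ map g (allFin M)) gx (∈-map⁺ g (∈-allFin x))

  collision⇒imageSize< : ∀ x y → ¬ x ≡ y → g x ≡ g y → imageSize < M
  collision⇒imageSize< x y x≢y gx≡gy =
    ≤-<-trans (distinctCount≤length _≟B_ ⊆without-x) (≤-<-trans (≤-reflexive (length-map g without-x))
      (<-≤-trans (filter-notAll ≢x? (allFin M) (Any.map (λ { refl f → f refl }) (∈-allFin x))) (≤-reflexive (length-tabulate id))))
    where
    ≢x? = λ w → ¬? (x ≟F w)
    without-x = filter ≢x? (allFin M)
    ⊆without-x : map g (allFin M) ⊆ map g without-x
    ⊆without-x z∈ with ∈-map⁻ g z∈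
    ... | w , _ , refl with x ≟F w
    ...   | yes refl = subst (_∈ map g without-x) (sym gx≡gy) (∈-map⁺ g (∈-filter⁺ ≢x? (∈-allFin y) x≢y))
    ...   | no x≢w = ∈-map⁺ g (∈-filter⁺ ≢x? (∈-allFin w) x≢w)

  two-collisions⇒suc-imageSize< : ∀ x y x′ y′ → ¬ x ≡ y → ¬ x ≡ x′ → ¬ y ≡ x′ → ¬ x ≡ y′ → ¬ y ≡ y′ →
                                  g x′ ≡ g x → g y′ ≡ g y → suc imageSize < M
  two-collisions⇒suc-imageSize< x y x′ y′ x≢y x≢x′ y≢x′ x≢y′ y≢y′ gx′≡gx gy′≡gy = begin
    suc (suc imageSize)            ≤⟨ s≤s (s≤s (distinctCount≤length _≟B_ ⊆without-xy)) ⟩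
    suc (suc (length (map g L₂)))  ≡⟨ cong (λ t → suc (suc t)) (length-map g L₂) ⟩
    suc (suc (length L₂))          ≤⟨ s≤s (filter-notAll ≢y? L₁ (Any.map (λ { refl f → f refl }) (∈-filter⁺ ≢x? (∈-allFin y) x≢y))) ⟩
    suc (length L₁)                ≤⟨ filter-notAll ≢x? (allFin M) (Any.map (λ { refl f → f refl }) (∈-allFin x)) ⟩
    length (allFin M)              ≡⟨ length-tabulate id ⟩
    M                              ∎
    where
    open ≤-Reasoning
    ≢x? = λ w → ¬? (x ≟F w)
    ≢y? = λ w → ¬? (y ≟F w)
    L₁ = filter ≢x? (allFin M)
    L₂ = filter ≢y? L₁
    ∈L₂ : ∀ w → ¬ x ≡ w → ¬ y ≡ w → w ∈ L₂
    ∈L₂ w x≢w y≢w = ∈-filter⁺ ≢y? (∈-filter⁺ ≢x? (∈-allFin w) x≢w) y≢w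
    ⊆without-xy : map g (allFin M) ⊆ map g L₂
    ⊆without-xy z∈ with ∈-map⁻ g z∈
    ... | w , _ , refl with x ≟F w | y ≟F w
    ...   | yes refl | _ = subst (_∈ map g L₂) gx′≡gx (∈-map⁺ g (∈L₂ x′ x≢x′ y≢x′))
    ...   | no _ | yes refl = subst (_∈ map g L₂) gy′≡gy (∈-map⁺ g (∈L₂ y′ x≢y′ y≢y′))
    ...   | no x≢w | no y≢w = ∈-map⁺ g (∈L₂ w x≢w y≢w)

  three-colliding⇒suc-imageSize< : ∀ a₁ a₂ a₃ b₁ b₂ b₃ → ¬ a₁ ≡ a₂ → ¬ a₁ ≡ a₃ → ¬ a₂ ≡ a₃ →
                                   ¬ b₁ ≡ a₁ → ¬ b₂ ≡ a₂ → ¬ b₃ ≡ a₃ → g b₁ ≡ g a₁ → g b₂ ≡ g a₂ → g b₃ ≡ g a₃ →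
                                   suc imageSize < M
  three-colliding⇒suc-imageSize< a₁ a₂ a₃ b₁ b₂ b₃ a₁≢a₂ a₁≢a₃ a₂≢a₃ b₁≢a₁ b₂≢a₂ b₃≢a₃ g₁ g₂ g₃ =
    cases (b₁ ≟F a₂) (b₂ ≟F a₁)
    where
    a₁a₂-collide : g a₁ ≡ g a₂ → Dec (b₃ ≡ a₁) → Dec (b₃ ≡ a₂) → suc imageSize < M
    a₁a₂-collide g₁₂ (yes b₃≡a₁) _ =
      two-collisions⇒suc-imageSize< a₁ a₂ a₃ a₃ a₁≢a₂ a₁≢a₃ a₂≢a₃ a₁≢a₃ a₂≢a₃ g₃a₁ (trans g₃a₁ g₁₂)
      where g₃a₁ = trans (sym g₃) (cong g b₃≡a₁)
    a₁a₂-collide g₁₂ (no _) (yes b₃≡a₂) =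
      two-collisions⇒suc-imageSize< a₁ a₂ a₃ a₃ a₁≢a₂ a₁≢a₃ a₂≢a₃ a₁≢a₃ a₂≢a₃ (trans g₃a₂ (sym g₁₂)) g₃a₂
      where g₃a₂ = trans (sym g₃) (cong g b₃≡a₂)
    a₁a₂-collide g₁₂ (no b₃≢a₁) (no _) =
      two-collisions⇒suc-imageSize< a₁ a₃ a₂ b₃ a₁≢a₃ a₁≢a₂ (≢-sym a₂≢a₃) (≢-sym b₃≢a₁) (≢-sym b₃≢a₃) (sym g₁₂) g₃
    cases : Dec (b₁ ≡ a₂) → Dec (b₂ ≡ a₁) → suc imageSize < M
    cases (yes b₁≡a₂) _ = a₁a₂-collide (trans (sym g₁) (cong g b₁≡a₂)) (b₃ ≟F a₁) (b₃ ≟F a₂)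
    cases (no _) (yes b₂≡a₁) = a₁a₂-collide (sym (trans (sym g₂) (cong g b₂≡a₁))) (b₃ ≟F a₁) (b₃ ≟F a₂)
    cases (no b₁≢a₂) (no b₂≢a₁) =
      two-collisions⇒suc-imageSize< a₁ a₂ b₁ b₂ a₁≢a₂ (≢-sym b₁≢a₁) (≢-sym b₁≢a₂) (≢-sym b₂≢a₁) (≢-sym b₂≢a₂) g₁ g₂

_⊆ᵛ_ : ∀ {n} → VSet n → VSet n → Set
S ⊆ᵛ X = ∀ i → lookup S i ≡ true → lookup X i ≡ true

_∪ᵛ_ : ∀ {n} → VSet n → VSet n → VSet n
u ∪ᵛ v = zipWith _∨_ u v

∅ᵛ : ∀ {n} → VSet n
∅ᵛ = replicate _ false

_∖ᵛ_ : ∀ {n} → VSet n → VSet n → VSet n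
X ∖ᵛ B = tabulate (λ v → lookup X v ∧ not (lookup B v))

size : ∀ {n} → VSet n → ℕ
size X = countF (lookup X)

_≟ᵛ_ : ∀ {n} → DecidableEquality (VSet n)
_≟ᵛ_ = ≡-dec _≟𝔹_

VSet-ext : ∀ {n} {u v : VSet n} → (∀ i → lookup u i ≡ lookup v i) → u ≡ v
VSet-ext {u = u} {v} h = trans (sym (tabulate∘lookup u)) (trans (tabulate-cong h) (tabulate∘lookup v))

lookup-∩ᵛ : ∀ {n} (u v : VSet n) i → lookup (u ∩ᵛ v) i ≡ lookup u i ∧ lookup v i
lookup-∩ᵛ u v i = lookup-zipWith _∧_ i u v

lookup-∪ᵛ : ∀ {n} (u v : VSet n) i → lookup (u ∪ᵛ v) i ≡ lookup u i ∨ lookup v i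
lookup-∪ᵛ u v i = lookup-zipWith _∨_ i u v

≡∅ᵛ : ∀ {n} (z : VSet n) → (∀ i → lookup z i ≡ false) → z ≡ ∅ᵛ
≡∅ᵛ z h = VSet-ext (λ i → trans (h i) (sym (lookup-replicate i false)))

⊆ᵇ-true⁻ : ∀ {n} (S X : VSet n) → S ⊆ᵇ X ≡ true → S ⊆ᵛ X
⊆ᵇ-true⁻ S X e i Sᵢ with false⊎true (lookup X i)
... | inj₂ Xᵢ = Xᵢ
... | inj₁ Xᵢ = ⊥-elim (true≢false (trans (sym (anyF-true⁺ _ i (∧-true⁺ Sᵢ (false⇒not≡true Xᵢ)))) (not≡true⇒false e)))

⊆ᵇ-true⁺ : ∀ {n} (S X : VSet n) → S ⊆ᵛ X → S ⊆ᵇ X ≡ true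
⊆ᵇ-true⁺ S X S⊆X = false⇒not≡true (anyF-false⁺ _ (λ i → bool-ext (λ e → outside i (∧-true⁻ {lookup S i} e)) (λ ())))
  where
  outside : ∀ i → lookup S i ≡ true × not (lookup X i) ≡ true → false ≡ true
  outside i (Sᵢ , ¬Xᵢ) = ⊥-elim (true≢false (trans (sym (S⊆X i Sᵢ)) (not≡true⇒false ¬Xᵢ)))

∈-allSubsets : ∀ {n} (S : VSet n) → S ∈ allSubsets n
∈-allSubsets [] = here refl
∈-allSubsets {suc n} (false ∷ S) = ∈-++⁺ˡ (∈-map⁺ (false ∷_) (∈-allSubsets S))
∈-allSubsets {suc n} (true ∷ S) = ∈-++⁺ʳ (map (false ∷_) (allSubsets n)) (∈-map⁺ (true ∷_) (∈-allSubsets S))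

subsetsOf : ∀ {n} → VSet n → List (VSet n)
subsetsOf [] = [] ∷ []
subsetsOf (false ∷ X) = map (false ∷_) (subsetsOf X)
subsetsOf (true ∷ X) = map (false ∷_) (subsetsOf X) ++ map (true ∷_) (subsetsOf X)

length-subsetsOf : ∀ {n} (X : VSet n) → length (subsetsOf X) ≡ 2 ^ size X
length-subsetsOf [] = refl
length-subsetsOf (false ∷ X) = trans (length-map (false ∷_) (subsetsOf X)) (length-subsetsOf X)
length-subsetsOf (true ∷ X) = begin
  length (map (false ∷_) (subsetsOf X) ++ map (true ∷_) (subsetsOf X))     ≡⟨ length-++ (map (false ∷_) (subsetsOf X)) ⟩
  length (map (false ∷_) (subsetsOf X)) + length (map (true ∷_) (subsetsOf X))
    ≡⟨ cong₂ _+_ (trans (length-map _ (subsetsOf X)) (length-subsetsOf X)) (trans (length-map _ (subsetsOf X)) (length-subsetsOf X)) ⟩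
  2 ^ size X + 2 ^ size X                                                  ≡⟨ cong (2 ^ size X +_) (sym (+-identityʳ (2 ^ size X))) ⟩
  2 ^ suc (size X)                                                         ∎
  where open ≡-Reasoning

∈-subsetsOf : ∀ {n} (X S : VSet n) → S ⊆ᵛ X → S ∈ subsetsOf X
∈-subsetsOf [] [] h = here refl
∈-subsetsOf (false ∷ X) (false ∷ S) h = ∈-map⁺ (false ∷_) (∈-subsetsOf X S (h ∘ suc))
∈-subsetsOf (false ∷ X) (true ∷ S) h = ⊥-elim (true≢false (sym (h zero refl)))
∈-subsetsOf (true ∷ X) (false ∷ S) h = ∈-++⁺ˡ (∈-map⁺ (false ∷_) (∈-subsetsOf X S (h ∘ suc)))
∈-subsetsOf (true ∷ X) (true ∷ S) h = ∈-++⁺ʳ (map (false ∷_) (subsetsOf X)) (∈-map⁺ (true ∷_) (∈-subsetsOf X S (h ∘ suc)))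

module _ (G : Graph) where

  private
    V = VSet (n G)

  nbhdIn : V → V → V
  nbhdIn Y S = nbhd G S ∩ᵛ Y

  -- boolCount G X Y unfolds to distinctCount _≟ᵛ_ (traces X Y).
  traces : V → V → List V
  traces X Y = map (nbhdIn Y) (filterᵇ (λ S → S ⊆ᵇ X) (allSubsets (n G)))

  ∈-traces⁻ : ∀ {X Y z} → z ∈ traces X Y → ∃ λ S → S ⊆ᵛ X × z ≡ nbhdIn Y S
  ∈-traces⁻ {X} {Y} z∈ with ∈-map⁻ (nbhdIn Y) z∈
  ... | S , S∈ , eq = S , ⊆ᵇ-true⁻ S X (T⇒≡true (proj₂ (∈-filter⁻ (λ S → T? (S ⊆ᵇ X)) {xs = allSubsets (n G)} S∈))) , eq

  ∈-traces⁺ : ∀ {X Y} S → S ⊆ᵛ X → nbhdIn Y S ∈ traces X Y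
  ∈-traces⁺ {X} {Y} S S⊆X = ∈-map⁺ (nbhdIn Y) (∈-filter⁺ (λ S → T? (S ⊆ᵇ X)) (∈-allSubsets S) (≡true⇒T (⊆ᵇ-true⁺ S X S⊆X)))

  lookup-nbhdIn : ∀ Y S y → lookup (nbhdIn Y S) y ≡ anyF (λ x → lookup S x ∧ adj G x y) ∧ lookup Y y
  lookup-nbhdIn Y S y = trans (lookup-zipWith _∧_ y (nbhd G S) Y) (cong (_∧ lookup Y y) (lookup∘tabulate _ y))

  boolCount-monoˡ : ∀ {X X′ : V} Y → X ⊆ᵛ X′ → boolCount G X Y ≤ boolCount G X′ Y
  boolCount-monoˡ {X} {X′} Y X⊆X′ = distinctCount-mono _≟ᵛ_ ⊆traces
    where
    ⊆traces : traces X Y ⊆ traces X′ Y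
    ⊆traces z∈ with ∈-traces⁻ {X} {Y} z∈
    ... | S , S⊆X , refl = ∈-traces⁺ {X′} {Y} S (λ i s → X⊆X′ i (S⊆X i s))

  boolCount-monoʳ : ∀ X {Y Y′ : V} → Y ⊆ᵛ Y′ → boolCount G X Y ≤ boolCount G X Y′
  boolCount-monoʳ X {Y} {Y′} Y⊆Y′ = distinctCount-image _≟ᵛ_ _≟ᵛ_ (_∩ᵛ Y) {xs = traces X Y} {ys = traces X Y′} restrict
    where
    pointwise : ∀ S y → lookup (nbhdIn Y S) y ≡ lookup (nbhdIn Y′ S ∩ᵛ Y) y
    pointwise S y rewrite lookup-∩ᵛ (nbhdIn Y′ S) Y y | lookup-nbhdIn Y S y | lookup-nbhdIn Y′ S y with false⊎true (lookup Y y)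
    ... | inj₁ e rewrite e | ∧-zeroʳ (anyF (λ x → lookup S x ∧ adj G x y) ∧ lookup Y′ y) = ∧-zeroʳ _
    ... | inj₂ e rewrite e | Y⊆Y′ y e = sym (∧-identityʳ _)
    restrict : ∀ {z} → z ∈ traces X Y → ∃ λ a → a ∈ traces X Y′ × z ≡ a ∩ᵛ Y
    restrict z∈ with ∈-traces⁻ {X} {Y} z∈
    ... | S , S⊆X , refl = nbhdIn Y′ S , ∈-traces⁺ {X} {Y′} S S⊆X , VSet-ext (pointwise S)

  boolCount-∪ˡ : ∀ (X X₁ X₂ Y : V) → (∀ i → lookup X i ≡ true → lookup X₁ i ≡ true ⊎ lookup X₂ i ≡ true) →
                 boolCount G X Y ≤ boolCount G X₁ Y * boolCount G X₂ Y
  boolCount-∪ˡ X X₁ X₂ Y cover =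
    distinctCount-image₂ _≟ᵛ_ _≟ᵛ_ _≟ᵛ_ _∪ᵛ_ {xs = traces X Y} {ys = traces X₁ Y} {zs = traces X₂ Y} split
    where
    ∈∩ᵛ : ∀ S Xᵢ i → lookup (S ∩ᵛ Xᵢ) i ≡ true → lookup S i ≡ true × lookup Xᵢ i ≡ true
    ∈∩ᵛ S Xᵢ i e = ∧-true⁻ (trans (sym (lookup-∩ᵛ S Xᵢ i)) e)
    adjacentFrom : V → Fin (n G) → Bool
    adjacentFrom T y = anyF (λ x → lookup T x ∧ adj G x y)
    into : ∀ S Xᵢ x y → lookup S x ≡ true → lookup Xᵢ x ≡ true → adj G x y ≡ true → adjacentFrom (S ∩ᵛ Xᵢ) y ≡ true
    into S Xᵢ x y Sx Xᵢx xy = anyF-true⁺ _ x (∧-true⁺ (trans (lookup-∩ᵛ S Xᵢ x) (∧-true⁺ Sx Xᵢx)) xy)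
    outof : ∀ S Xᵢ y → adjacentFrom (S ∩ᵛ Xᵢ) y ≡ true → adjacentFrom S y ≡ true
    outof S Xᵢ y = anyF-mono _ _ (λ x e → let (s , xy) = ∧-true⁻ e in ∧-true⁺ (proj₁ (∈∩ᵛ S Xᵢ x s)) xy)
    pointwise : ∀ S → S ⊆ᵛ X → ∀ y → lookup (nbhdIn Y S) y ≡ lookup (nbhdIn Y (S ∩ᵛ X₁) ∪ᵛ nbhdIn Y (S ∩ᵛ X₂)) y
    pointwise S S⊆X y rewrite lookup-∪ᵛ (nbhdIn Y (S ∩ᵛ X₁)) (nbhdIn Y (S ∩ᵛ X₂)) y | lookup-nbhdIn Y S y
                            | lookup-nbhdIn Y (S ∩ᵛ X₁) y | lookup-nbhdIn Y (S ∩ᵛ X₂) y = bool-ext fwd bwd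
      where
      fwd : adjacentFrom S y ∧ lookup Y y ≡ true →
            (adjacentFrom (S ∩ᵛ X₁) y ∧ lookup Y y) ∨ (adjacentFrom (S ∩ᵛ X₂) y ∧ lookup Y y) ≡ true
      fwd e with ∧-true⁻ e
      ... | a , Yy with anyF-true⁻ _ a
      ... | x , ex with ∧-true⁻ ex
      ... | Sx , xy with cover x (S⊆X x Sx)
      ... | inj₁ X₁x = ∨-trueˡ (∧-true⁺ (into S X₁ x y Sx X₁x xy) Yy)
      ... | inj₂ X₂x = ∨-trueʳ {adjacentFrom (S ∩ᵛ X₁) y ∧ lookup Y y} (∧-true⁺ (into S X₂ x y Sx X₂x xy) Yy)
      bwd : (adjacentFrom (S ∩ᵛ X₁) y ∧ lookup Y y) ∨ (adjacentFrom (S ∩ᵛ X₂) y ∧ lookup Y y) ≡ true →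
            adjacentFrom S y ∧ lookup Y y ≡ true
      bwd e with ∨-true⁻ {adjacentFrom (S ∩ᵛ X₁) y ∧ lookup Y y} e
      ... | inj₁ e₁ = let (a , Yy) = ∧-true⁻ e₁ in ∧-true⁺ (outof S X₁ y a) Yy
      ... | inj₂ e₂ = let (a , Yy) = ∧-true⁻ e₂ in ∧-true⁺ (outof S X₂ y a) Yy
    split : ∀ {z} → z ∈ traces X Y → ∃₂ λ a b → a ∈ traces X₁ Y × b ∈ traces X₂ Y × z ≡ a ∪ᵛ b
    split z∈ with ∈-traces⁻ {X} {Y} z∈
    ... | S , S⊆X , refl = nbhdIn Y (S ∩ᵛ X₁) , nbhdIn Y (S ∩ᵛ X₂) ,
          ∈-traces⁺ {X₁} {Y} (S ∩ᵛ X₁) (λ i e → proj₂ (∈∩ᵛ S X₁ i e)) ,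
          ∈-traces⁺ {X₂} {Y} (S ∩ᵛ X₂) (λ i e → proj₂ (∈∩ᵛ S X₂ i e)) ,
          VSet-ext (pointwise S S⊆X)

  boolCount-∪ʳ : ∀ (X Y Y₁ Y₂ : V) → (∀ i → lookup Y i ≡ true → lookup Y₁ i ≡ true ⊎ lookup Y₂ i ≡ true) →
                 boolCount G X Y ≤ boolCount G X Y₁ * boolCount G X Y₂
  boolCount-∪ʳ X Y Y₁ Y₂ cover =
    distinctCount-image₂ _≟ᵛ_ _≟ᵛ_ _≟ᵛ_ (λ a b → (a ∪ᵛ b) ∩ᵛ Y) {xs = traces X Y} {ys = traces X Y₁} {zs = traces X Y₂} split
    where
    distrib : ∀ a b c d → (b ≡ true → c ≡ true ⊎ d ≡ true) → a ∧ b ≡ ((a ∧ c) ∨ (a ∧ d)) ∧ b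
    distrib false b c d h = refl
    distrib true false c d h = sym (∧-zeroʳ (c ∨ d))
    distrib true true true d h = refl
    distrib true true false true h = refl
    distrib true true false false h with h refl
    ... | inj₁ ()
    ... | inj₂ ()
    pointwise : ∀ S y → lookup (nbhdIn Y S) y ≡ lookup ((nbhdIn Y₁ S ∪ᵛ nbhdIn Y₂ S) ∩ᵛ Y) y
    pointwise S y rewrite lookup-∩ᵛ (nbhdIn Y₁ S ∪ᵛ nbhdIn Y₂ S) Y y | lookup-∪ᵛ (nbhdIn Y₁ S) (nbhdIn Y₂ S) y
                        | lookup-nbhdIn Y S y | lookup-nbhdIn Y₁ S y | lookup-nbhdIn Y₂ S y
      = distrib _ (lookup Y y) (lookup Y₁ y) (lookup Y₂ y) (cover y)
    split : ∀ {z} → z ∈ traces X Y → ∃₂ λ a b → a ∈ traces X Y₁ × b ∈ traces X Y₂ × z ≡ (a ∪ᵛ b) ∩ᵛ Y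
    split z∈ with ∈-traces⁻ {X} {Y} z∈
    ... | S , S⊆X , refl = nbhdIn Y₁ S , nbhdIn Y₂ S , ∈-traces⁺ {X} {Y₁} S S⊆X , ∈-traces⁺ {X} {Y₂} S S⊆X , VSet-ext (pointwise S)

  boolCount≤2^sizeˡ : ∀ (X Y : V) → boolCount G X Y ≤ 2 ^ size X
  boolCount≤2^sizeˡ X Y =
    ≤-trans (distinctCount-image _≟ᵛ_ _≟ᵛ_ (nbhdIn Y) {xs = traces X Y} {ys = subsetsOf X} fromSubset)
            (≤-trans (distinctCount≤length _≟ᵛ_ {xs = subsetsOf X} {ys = subsetsOf X} id) (≤-reflexive (length-subsetsOf X)))
    where
    fromSubset : ∀ {z} → z ∈ traces X Y → ∃ λ a → a ∈ subsetsOf X × z ≡ nbhdIn Y a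
    fromSubset z∈ with ∈-traces⁻ {X} {Y} z∈
    ... | S , S⊆X , refl = S , ∈-subsetsOf X S S⊆X , refl

  boolCount≤2^sizeʳ : ∀ (X Y : V) → boolCount G X Y ≤ 2 ^ size Y
  boolCount≤2^sizeʳ X Y = ≤-trans (distinctCount≤length _≟ᵛ_ {xs = traces X Y} {ys = subsetsOf Y} ⊆subsets) (≤-reflexive (length-subsetsOf Y))
    where
    ⊆subsets : traces X Y ⊆ subsetsOf Y
    ⊆subsets z∈ with ∈-traces⁻ {X} {Y} z∈
    ... | S , _ , refl = ∈-subsetsOf Y (nbhdIn Y S) (λ i e → proj₂ (∧-true⁻ (trans (sym (lookup-nbhdIn Y S i)) e)))

  boolCount-homogeneousˡ : ∀ (X Y : V) →
    (∀ y → lookup Y y ≡ true → ∀ x x′ → lookup X x ≡ true → lookup X x′ ≡ true → adj G x y ≡ adj G x′ y) → boolCount G X Y ≤ 2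
  boolCount-homogeneousˡ X Y hom = distinctCount≤2 _≟ᵛ_ (nbhdIn Y X) ∅ᵛ whole-or-empty
    where
    adjacent-via : ∀ y → lookup Y y ≡ true → ∀ x₀ T → T ⊆ᵛ X → lookup T x₀ ≡ true → anyF (λ x → lookup T x ∧ adj G x y) ≡ adj G x₀ y
    adjacent-via y Yy x₀ T T⊆X Tx₀ = bool-ext
      (λ a → let (x , ex) = anyF-true⁻ _ a ; (Tx , xy) = ∧-true⁻ ex in trans (hom y Yy x₀ x (T⊆X x₀ Tx₀) (T⊆X x Tx)) xy)
      (λ x₀y → anyF-true⁺ _ x₀ (∧-true⁺ Tx₀ x₀y))
    nonempty : ∀ S → S ⊆ᵛ X → ∀ x₀ → lookup S x₀ ≡ true → ∀ y → lookup (nbhdIn Y S) y ≡ lookup (nbhdIn Y X) y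
    nonempty S S⊆X x₀ Sx₀ y rewrite lookup-nbhdIn Y S y | lookup-nbhdIn Y X y with false⊎true (lookup Y y)
    ... | inj₁ e rewrite e = trans (∧-zeroʳ _) (sym (∧-zeroʳ _))
    ... | inj₂ e rewrite e = cong (_∧ true) (trans (adjacent-via y e x₀ S S⊆X Sx₀) (sym (adjacent-via y e x₀ X (λ i z → z) (S⊆X x₀ Sx₀))))
    empty : ∀ S → anyF (lookup S) ≡ false → ∀ y → lookup (nbhdIn Y S) y ≡ false
    empty S e y rewrite lookup-nbhdIn Y S y = cong (_∧ lookup Y y) (anyF-false⁺ _ (λ x → cong (_∧ adj G x y) (anyF-false⁻ _ e x)))
    whole-or-empty : ∀ {z} → z ∈ traces X Y → z ≡ nbhdIn Y X ⊎ z ≡ ∅ᵛ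
    whole-or-empty z∈ with ∈-traces⁻ {X} {Y} z∈
    ... | S , S⊆X , refl with false⊎true (anyF (lookup S))
    ...   | inj₂ e = let (x₀ , Sx₀) = anyF-true⁻ _ e in inj₁ (VSet-ext (nonempty S S⊆X x₀ Sx₀))
    ...   | inj₁ e = inj₂ (≡∅ᵛ _ (empty S e))

  boolCount-homogeneousʳ : ∀ (X Y : V) →
    (∀ x → lookup X x ≡ true → ∀ y y′ → lookup Y y ≡ true → lookup Y y′ ≡ true → adj G x y ≡ adj G x y′) → boolCount G X Y ≤ 2
  boolCount-homogeneousʳ X Y hom = distinctCount≤2 _≟ᵛ_ Y ∅ᵛ whole-or-empty
    where
    whole : ∀ S → S ⊆ᵛ X → ∀ y₀ → lookup (nbhdIn Y S) y₀ ≡ true → ∀ y → lookup (nbhdIn Y S) y ≡ lookup Y y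
    whole S S⊆X y₀ Ny₀ y with ∧-true⁻ (trans (sym (lookup-nbhdIn Y S y₀)) Ny₀)
    ... | a , Yy₀ with anyF-true⁻ _ a
    ... | x₀ , ex₀ with ∧-true⁻ ex₀
    ... | Sx₀ , x₀y₀ rewrite lookup-nbhdIn Y S y with false⊎true (lookup Y y)
    ...   | inj₁ e rewrite e = ∧-zeroʳ _
    ...   | inj₂ e rewrite e = trans (∧-identityʳ _) (anyF-true⁺ _ x₀ (∧-true⁺ Sx₀ (trans (hom x₀ (S⊆X x₀ Sx₀) y y₀ e Yy₀) x₀y₀)))
    whole-or-empty : ∀ {z} → z ∈ traces X Y → z ≡ Y ⊎ z ≡ ∅ᵛ
    whole-or-empty z∈ with ∈-traces⁻ {X} {Y} z∈
    ... | S , S⊆X , refl with false⊎true (anyF (lookup (nbhdIn Y S)))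
    ...   | inj₁ e = inj₂ (≡∅ᵛ _ (anyF-false⁻ _ e))
    ...   | inj₂ e = let (y₀ , Ny₀) = anyF-true⁻ _ e in inj₁ (VSet-ext (whole S S⊆X y₀ Ny₀))

  boolCount-⋃ˡ : ∀ {m} (F : Fin m → V) (X Y : V) → (∀ x → lookup X x ≡ true → ∃ λ a → lookup (F a) x ≡ true) →
                 boolCount G X Y ≤ prodF (λ a → boolCount G (F a) Y)
  boolCount-⋃ˡ {zero} F X Y cover = ≤-trans (boolCount≤2^sizeˡ X Y) (≤-reflexive (cong (2 ^_) (countF-zero (lookup X) X-empty)))
    where
    X-empty : ∀ x → lookup X x ≡ false
    X-empty x with false⊎true (lookup X x)
    ... | inj₁ e = e
    ... | inj₂ e with cover x e
    ... | () , _
  boolCount-⋃ˡ {suc m} F X Y cover =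
    ≤-trans (boolCount-∪ˡ X (F zero) X′ Y split) (*-mono-≤ (≤-refl {boolCount G (F zero) Y}) (boolCount-⋃ˡ (F ∘ suc) X′ Y cover′))
    where
    X′ = tabulate (λ x → anyF (λ a → lookup (F (suc a)) x))
    split : ∀ i → lookup X i ≡ true → lookup (F zero) i ≡ true ⊎ lookup X′ i ≡ true
    split i e with cover i e
    ... | zero , e₀ = inj₁ e₀
    ... | suc a , eₐ = inj₂ (trans (lookup∘tabulate _ i) (anyF-true⁺ _ a eₐ))
    cover′ : ∀ x → lookup X′ x ≡ true → ∃ λ a → lookup (F (suc a)) x ≡ true
    cover′ x e = anyF-true⁻ _ (trans (sym (lookup∘tabulate _ x)) e)

  boolCount-⋃ʳ : ∀ {m} (F : Fin m → V) (X Y : V) → (∀ y → lookup Y y ≡ true → ∃ λ a → lookup (F a) y ≡ true) →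
                 boolCount G X Y ≤ prodF (λ a → boolCount G X (F a))
  boolCount-⋃ʳ {zero} F X Y cover = ≤-trans (boolCount≤2^sizeʳ X Y) (≤-reflexive (cong (2 ^_) (countF-zero (lookup Y) Y-empty)))
    where
    Y-empty : ∀ y → lookup Y y ≡ false
    Y-empty y with false⊎true (lookup Y y)
    ... | inj₁ e = e
    ... | inj₂ e with cover y e
    ... | () , _
  boolCount-⋃ʳ {suc m} F X Y cover =
    ≤-trans (boolCount-∪ʳ X Y (F zero) Y′ split) (*-mono-≤ (≤-refl {boolCount G X (F zero)}) (boolCount-⋃ʳ (F ∘ suc) X Y′ cover′))
    where
    Y′ = tabulate (λ y → anyF (λ a → lookup (F (suc a)) y))
    split : ∀ i → lookup Y i ≡ true → lookup (F zero) i ≡ true ⊎ lookup Y′ i ≡ true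
    split i e with cover i e
    ... | zero , e₀ = inj₁ e₀
    ... | suc a , eₐ = inj₂ (trans (lookup∘tabulate _ i) (anyF-true⁺ _ a eₐ))
    cover′ : ∀ y → lookup Y′ y ≡ true → ∃ λ a → lookup (F (suc a)) y ≡ true
    cover′ y e = anyF-true⁻ _ (trans (sym (lookup∘tabulate _ y)) e)

  cutBool≤-extend : ∀ (B X : V) c d → B ⊆ᵛ X → size (X ∖ᵛ B) ≤ d → cutBool≤ G B c → cutBool≤ G X (c + d)
  cutBool≤-extend B X c d B⊆X few-extra (B→rest , rest→B) = X→rest , rest→X
    where
    split : ∀ v → lookup X v ≡ true → lookup B v ≡ true ⊎ lookup (X ∖ᵛ B) v ≡ true
    split v Xv with false⊎true (lookup B v)
    ... | inj₂ Bv = inj₁ Bv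
    ... | inj₁ ¬Bv = inj₂ (trans (lookup∘tabulate _ v) (∧-true⁺ Xv (cong not ¬Bv)))
    compl-X⊆compl-B : compl X ⊆ᵛ compl B
    compl-X⊆compl-B u e with false⊎true (lookup B u)
    ... | inj₁ ¬Bu = trans (lookup∘tabulate _ u) (cong not ¬Bu)
    ... | inj₂ Bu = ⊥-elim (true≢false (trans (sym (B⊆X u Bu)) (not≡true⇒false (trans (sym (lookup∘tabulate _ u)) e))))
    combine : ∀ {a b} → a ≤ 2 ^ c → b ≤ 2 ^ size (X ∖ᵛ B) → a * b ≤ 2 ^ (c + d)
    combine a≤ b≤ = ≤-trans (*-mono-≤ a≤ (≤-trans b≤ (^-monoʳ-≤ 2 few-extra))) (≤-reflexive (sym (^-distribˡ-+-* 2 c d)))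
    X→rest : boolCount G X (compl X) ≤ 2 ^ (c + d)
    X→rest = ≤-trans (boolCount-∪ˡ X B (X ∖ᵛ B) (compl X) split)
               (combine (≤-trans (boolCount-monoʳ B compl-X⊆compl-B) B→rest) (boolCount≤2^sizeˡ (X ∖ᵛ B) (compl X)))
    rest→X : boolCount G (compl X) X ≤ 2 ^ (c + d)
    rest→X = ≤-trans (boolCount-∪ʳ (compl X) X B (X ∖ᵛ B) split)
               (combine (≤-trans (boolCount-monoˡ {compl X} {compl B} B compl-X⊆compl-B) rest→B) (boolCount≤2^sizeʳ (compl X) (X ∖ᵛ B)))

  singleton-cut : ∀ v K → 1 ≤ K → cutBool≤ G (singletonSet v) K
  singleton-cut v K 1≤K = ≤-trans (boolCount≤2^sizeˡ X (compl X)) bound , ≤-trans (boolCount≤2^sizeʳ (compl X) X) bound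
    where
    X = singletonSet v
    size≤1 : size X ≤ 1
    size≤1 = countF≤1 (lookup X) (λ x y ex ey → trans (is-v x ex) (sym (is-v y ey)))
      where
      is-v : ∀ u → lookup X u ≡ true → u ≡ v
      is-v u e = ⌊⌋-true⁻ (u ≟F v) (trans (sym (lookup∘tabulate (λ u → ⌊ u ≟F v ⌋) u)) e)
    bound : 2 ^ size X ≤ 2 ^ K
    bound = ^-monoʳ-≤ 2 (≤-trans size≤1 1≤K)

  lookup-nbhdIn-singleton : ∀ Y x z → lookup (nbhdIn Y (singletonSet x)) z ≡ adj G x z ∧ lookup Y z
  lookup-nbhdIn-singleton Y x z = trans (lookup-nbhdIn Y (singletonSet x) z) (cong (_∧ lookup Y z) (bool-ext forward backward))
    where
    in-singleton : ∀ u → lookup (singletonSet x) u ≡ true → u ≡ x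
    in-singleton u e = ⌊⌋-true⁻ (u ≟F x) (trans (sym (lookup∘tabulate (λ w → ⌊ w ≟F x ⌋) u)) e)
    forward : anyF (λ u → lookup (singletonSet x) u ∧ adj G u z) ≡ true → adj G x z ≡ true
    forward e with anyF-true⁻ _ e
    ... | u , eu with ∧-true⁻ {lookup (singletonSet x) u} eu
    ... | u∈ , uz = subst (λ w → adj G w z ≡ true) (in-singleton u u∈) uz
    backward : adj G x z ≡ true → anyF (λ u → lookup (singletonSet x) u ∧ adj G u z) ≡ true
    backward e = anyF-true⁺ (λ u → lookup (singletonSet x) u ∧ adj G u z) x
                   (∧-true⁺ (trans (lookup∘tabulate (λ w → ⌊ w ≟F x ⌋) x) (⌊⌋-true⁺ (x ≟F x) refl)) e)

module PartitionFacts (G : Graph) {m : ℕ} (p : Fin (n G) → Fin m) where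

  nontrivial : Fin m → Bool
  nontrivial a = 2 ≤ᵇ countF (inPart p a)

  before : Fin m → Fin m → Bool
  before a b = suc (toℕ a) ≤ᵇ toℕ b

  red : Fin m → Fin m → Bool
  red = nonHomogeneous G p

  inPart-self : ∀ x → inPart p (p x) x ≡ true
  inPart-self x = ⌊⌋-true⁺ (p x ≟F p x) refl

  trivial⇒singleton : ∀ y y′ → nontrivial (p y) ≡ false → inPart p (p y) y′ ≡ true → y′ ≡ y
  trivial⇒singleton y y′ trivial e with y′ ≟F y
  ... | yes y′≡y = y′≡y
  ... | no y′≢y = ⊥-elim (true≢false (trans (sym (≤ᵇ-true⁺ (countF≥2 (inPart p (p y)) y′ y e (inPart-self y) y′≢y))) trivial))

  red-sym : ∀ a b → red a b ≡ red b a
  red-sym a b = cong₂ _∧_ (swapped (adj G) (Graph.sym G)) (swapped (λ x y → not (adj G x y)) (λ x y → cong not (Graph.sym G x y)))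
    where
    pointwise : ∀ (h : Fin (n G) → Fin (n G) → Bool) → (∀ x y → h x y ≡ h y x) →
                ∀ x y → (inPart p a x ∧ inPart p b y ∧ h x y) ≡ (inPart p b y ∧ inPart p a x ∧ h y x)
    pointwise h h-sym x y with inPart p a x | inPart p b y
    ... | true | true = h-sym x y
    ... | true | false = refl
    ... | false | true = refl
    ... | false | false = refl
    swapped : ∀ (h : Fin (n G) → Fin (n G) → Bool) → (∀ x y → h x y ≡ h y x) →
              anyF (λ x → anyF (λ y → inPart p a x ∧ inPart p b y ∧ h x y)) ≡ anyF (λ x → anyF (λ y → inPart p b x ∧ inPart p a y ∧ h x y))
    swapped h h-sym = trans (anyF-cong (λ x → anyF-cong (λ y → pointwise h h-sym x y))) (anyF-swap (λ y x → inPart p b x ∧ inPart p a y ∧ h x y))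

  red-true⁺ : ∀ a b x y x′ y′ → inPart p a x ≡ true → inPart p b y ≡ true → adj G x y ≡ true →
              inPart p a x′ ≡ true → inPart p b y′ ≡ true → adj G x′ y′ ≡ false → red a b ≡ true
  red-true⁺ a b x y x′ y′ ax by xy ax′ by′ x′y′ = ∧-true⁺
    (anyF-true⁺ _ x (anyF-true⁺ (λ y → inPart p a x ∧ inPart p b y ∧ adj G x y) y (∧-true⁺ ax (∧-true⁺ by xy))))
    (anyF-true⁺ _ x′ (anyF-true⁺ (λ y → inPart p a x′ ∧ inPart p b y ∧ not (adj G x′ y)) y′
      (∧-true⁺ ax′ (∧-true⁺ by′ (false⇒not≡true x′y′)))))

  red-true⁻ : ∀ a b → red a b ≡ true →
              ∃₂ λ x y → ∃₂ λ x′ y′ → p x ≡ a × p y ≡ b × p x′ ≡ a × p y′ ≡ b × adj G x y ≡ true × adj G x′ y′ ≡ false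
  red-true⁻ a b e with ∧-true⁻ e
  ... | e₁ , e₂ with anyF-true⁻ _ e₁ | anyF-true⁻ _ e₂
  ... | x , d₁ | x′ , d₂ with anyF-true⁻ _ d₁ | anyF-true⁻ _ d₂
  ... | y , f₁ | y′ , f₂ with ∧-true⁻ {inPart p a x} f₁ | ∧-true⁻ {inPart p a x′} f₂
  ... | ax , r₁ | ax′ , r₂ with ∧-true⁻ {inPart p b y} r₁ | ∧-true⁻ {inPart p b y′} r₂
  ... | by , xy | by′ , x′y′ =
    x , y , x′ , y′ , ⌊⌋-true⁻ (p x ≟F a) ax , ⌊⌋-true⁻ (p y ≟F b) by , ⌊⌋-true⁻ (p x′ ≟F a) ax′ ,
    ⌊⌋-true⁻ (p y′ ≟F b) by′ , xy , not≡true⇒false x′y′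

module FewRedEdges (G : Graph) (k : ℕ) {m : ℕ} (p : Fin (n G) → Fin m) (few : redCount G p ≤ k) where

  open PartitionFacts G p

  private
    V = VSet (n G)

  merged : Fin (n G) → Bool
  merged x = nontrivial (p x)

  hasRedEdge : Fin m → Bool
  hasRedEdge b = anyF (λ a → (before a b ∧ red a b) ∨ (before b a ∧ red b a))

  Merged RedSingletons QuietSingletons : V
  Merged = tabulate merged
  RedSingletons = tabulate (λ y → not (merged y) ∧ hasRedEdge (p y))
  QuietSingletons = tabulate (λ y → not (merged y) ∧ not (hasRedEdge (p y)))

  partIfNontrivial : Fin m → V
  partIfNontrivial a = tabulate (λ x → inPart p a x ∧ nontrivial a)

  redEdgeCount : ℕ
  redEdgeCount = sumF (λ a → countF (λ b → before a b ∧ red a b))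

  redEdgeCount≤k : redEdgeCount ≤ k
  redEdgeCount≤k = ≤-trans (m≤m+n redEdgeCount _) few

  nontrivialCount≤k : countF nontrivial ≤ k
  nontrivialCount≤k = ≤-trans (m≤n+m _ redEdgeCount) few

  size-RedSingletons : size RedSingletons ≤ k + k
  size-RedSingletons = begin
    size RedSingletons                                  ≡⟨ countF-cong (lookup∘tabulate (λ y → not (merged y) ∧ hasRedEdge (p y))) ⟩
    countF (λ y → not (merged y) ∧ hasRedEdge (p y))    ≤⟨ countF-injection _ hasRedEdge p injective (λ x e → proj₂ (∧-true⁻ e)) ⟩
    countF hasRedEdge                                   ≤⟨ countF-mono split ⟩
    countF (λ b → redFromBefore b ∨ redToAfter b)       ≤⟨ countF-∨ redFromBefore redToAfter ⟩
    countF redFromBefore + countF redToAfter            ≤⟨ +-mono-≤ (≤-trans fromBefore≤ redEdgeCount≤k) (≤-trans toAfter≤ redEdgeCount≤k) ⟩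
    k + k                                               ∎
    where
    open ≤-Reasoning
    redFromBefore redToAfter : Fin m → Bool
    redFromBefore b = anyF (λ a → before a b ∧ red a b)
    redToAfter b = anyF (λ a → before b a ∧ red b a)
    split : ∀ b → hasRedEdge b ≡ true → (redFromBefore b ∨ redToAfter b) ≡ true
    split b e with anyF-true⁻ _ e
    ... | a , eₐ with ∨-true⁻ {before a b ∧ red a b} eₐ
    ... | inj₁ r = ∨-trueˡ (anyF-true⁺ _ a r)
    ... | inj₂ r = ∨-trueʳ {redFromBefore b} (anyF-true⁺ _ a r)
    fromBefore≤ : countF redFromBefore ≤ redEdgeCount
    fromBefore≤ = ≤-trans (countF-anyF (λ b a → before a b ∧ red a b)) (≤-reflexive (sumF-swap (λ b a → indicator (before a b ∧ red a b))))
    toAfter≤ : countF redToAfter ≤ redEdgeCount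
    toAfter≤ = countF-anyF (λ b a → before b a ∧ red b a)
    injective : ∀ x y → (not (merged x) ∧ hasRedEdge (p x)) ≡ true → (not (merged y) ∧ hasRedEdge (p y)) ≡ true → p x ≡ p y → x ≡ y
    injective x y _ ey pxy = trivial⇒singleton y x (not≡true⇒false (proj₁ (∧-true⁻ ey)))
                                                (trans (cong (λ c → ⌊ c ≟F p y ⌋) pxy) (inPart-self y))

  no-red-edge : ∀ a b → nontrivial a ≡ true → nontrivial b ≡ false → hasRedEdge b ≡ false → red a b ≡ false
  no-red-edge a b a-nontrivial b-trivial no-red with <-cmp (toℕ a) (toℕ b) | ∨-false⁻ {before a b ∧ red a b} (anyF-false⁻ _ no-red a)
  ... | tri≈ _ a≡b _ | _ = ⊥-elim (true≢false (trans (sym a-nontrivial) (trans (cong nontrivial (toℕ-injective a≡b)) b-trivial)))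
  ... | tri< a<b _ _ | ¬red-ab , _ = trans (sym (cong (_∧ red a b) (≤ᵇ-true⁺ a<b))) ¬red-ab
  ... | tri> _ _ b<a | _ , ¬red-ba = trans (red-sym a b) (trans (sym (cong (_∧ red b a) (≤ᵇ-true⁺ b<a))) ¬red-ba)

  quiet-homogeneous : ∀ a y x x′ → lookup QuietSingletons y ≡ true → lookup (partIfNontrivial a) x ≡ true →
                      lookup (partIfNontrivial a) x′ ≡ true → adj G x y ≡ adj G x′ y
  quiet-homogeneous a y x x′ Qy ax ax′
    with ∧-true⁻ {not (merged y)} (trans (sym (lookup∘tabulate _ y)) Qy)
       | ∧-true⁻ {inPart p a x} (trans (sym (lookup∘tabulate _ x)) ax)
       | ∧-true⁻ {inPart p a x′} (trans (sym (lookup∘tabulate _ x′)) ax′)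
  ... | ¬merged , ¬hasRed | x∈a , a-nontrivial | x′∈a , _
    with no-red-edge a (p y) a-nontrivial (not≡true⇒false ¬merged) (not≡true⇒false ¬hasRed)
  ... | ¬red with adj G x y in xy | adj G x′ y in x′y
  ... | true | true = refl
  ... | false | false = refl
  ... | true | false = ⊥-elim (true≢false (trans (sym (red-true⁺ a (p y) x y x′ y x∈a (inPart-self y) xy x′∈a (inPart-self y) x′y)) ¬red))
  ... | false | true = ⊥-elim (true≢false (trans (sym (red-true⁺ a (p y) x′ y x y x′∈a (inPart-self y) x′y x∈a (inPart-self y) xy)) ¬red))

  complement-split : ∀ y → lookup (compl Merged) y ≡ true → lookup RedSingletons y ≡ true ⊎ lookup QuietSingletons y ≡ true
  complement-split y e with hasRedEdge (p y) in hr
  ... | true = inj₁ (trans (lookup∘tabulate _ y) (∧-true⁺ ¬merged hr))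
    where ¬merged = trans (sym (cong not (lookup∘tabulate merged y))) (trans (sym (lookup∘tabulate _ y)) e)
  ... | false = inj₂ (trans (lookup∘tabulate _ y) (∧-true⁺ ¬merged (cong not hr)))
    where ¬merged = trans (sym (cong not (lookup∘tabulate merged y))) (trans (sym (lookup∘tabulate _ y)) e)

  parts-cover : ∀ x → lookup Merged x ≡ true → ∃ λ a → lookup (partIfNontrivial a) x ≡ true
  parts-cover x e = p x , trans (lookup∘tabulate _ x) (∧-true⁺ (inPart-self x) (trans (sym (lookup∘tabulate merged x)) e))

  size-trivial-part : ∀ a → nontrivial a ≡ false → size (partIfNontrivial a) ≡ 0
  size-trivial-part a e = countF-zero _ (λ x → trans (lookup∘tabulate _ x) (trans (cong (inPart p a x ∧_) e) (∧-zeroʳ (inPart p a x))))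

  Merged-cut : cutBool≤ G Merged (k + k + k)
  Merged-cut = toRest , fromRest
    where
    open ≤-Reasoning
    finish : ∀ {a b} → a ≤ 2 ^ (k + k) → b ≤ 2 ^ k → a * b ≤ 2 ^ (k + k + k)
    finish a≤ b≤ = ≤-trans (*-mono-≤ a≤ b≤) (≤-reflexive (sym (^-distribˡ-+-* 2 (k + k) k)))
    perPartˡ : ∀ a → boolCount G (partIfNontrivial a) QuietSingletons ≤ (if nontrivial a then 2 else 1)
    perPartˡ a = if-≤ (nontrivial a)
      (λ _ → boolCount-homogeneousˡ G (partIfNontrivial a) QuietSingletons (λ y Qy x x′ ax ax′ → quiet-homogeneous a y x x′ Qy ax ax′))
      (λ e → ≤-trans (boolCount≤2^sizeˡ G (partIfNontrivial a) QuietSingletons) (≤-reflexive (cong (2 ^_) (size-trivial-part a e))))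
    perPartʳ : ∀ a → boolCount G QuietSingletons (partIfNontrivial a) ≤ (if nontrivial a then 2 else 1)
    perPartʳ a = if-≤ (nontrivial a)
      (λ _ → boolCount-homogeneousʳ G QuietSingletons (partIfNontrivial a) (λ y Qy x x′ ax ax′ →
               trans (Graph.sym G y x) (trans (quiet-homogeneous a y x x′ Qy ax ax′) (Graph.sym G x′ y))))
      (λ e → ≤-trans (boolCount≤2^sizeʳ G QuietSingletons (partIfNontrivial a)) (≤-reflexive (cong (2 ^_) (size-trivial-part a e))))
    toRest : boolCount G Merged (compl Merged) ≤ 2 ^ (k + k + k)
    toRest = ≤-trans (boolCount-∪ʳ G Merged (compl Merged) RedSingletons QuietSingletons complement-split)
      (finish (≤-trans (boolCount≤2^sizeʳ G Merged RedSingletons) (^-monoʳ-≤ 2 size-RedSingletons))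
              (≤-trans (boolCount-⋃ˡ G partIfNontrivial Merged QuietSingletons parts-cover)
                 (≤-trans (prodF≤2^countF _ nontrivial perPartˡ) (^-monoʳ-≤ 2 nontrivialCount≤k))))
    fromRest : boolCount G (compl Merged) Merged ≤ 2 ^ (k + k + k)
    fromRest = ≤-trans (boolCount-∪ˡ G (compl Merged) RedSingletons QuietSingletons Merged complement-split)
      (finish (≤-trans (boolCount≤2^sizeˡ G RedSingletons Merged) (^-monoʳ-≤ 2 size-RedSingletons))
              (≤-trans (boolCount-⋃ʳ G partIfNontrivial QuietSingletons Merged parts-cover)
                 (≤-trans (prodF≤2^countF _ nontrivial perPartʳ) (^-monoʳ-≤ 2 nontrivialCount≤k))))

module RedEdgesOfTwinPartition (G : Graph) {m : ℕ} (p : Fin (n G) → Fin m) (Z : Fin (n G) → Bool) (M : ℕ)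
  (shared⇒inZ : ∀ x y → p x ≡ p y → ¬ x ≡ y → Z x ≡ true)
  (twins-outside-Z : ∀ x x′ y → Z x ≡ true → Z x′ ≡ true → p x ≡ p x′ → Z y ≡ false → adj G x y ≡ adj G x′ y)
  (touching≤M : countF (λ a → anyF (λ x → Z x ∧ inPart p a x)) ≤ M) where

  open PartitionFacts G p

  touchesZ : Fin m → Bool
  touchesZ a = anyF (λ x → Z x ∧ inPart p a x)

  touchesZ⁺ : ∀ x → Z x ≡ true → touchesZ (p x) ≡ true
  touchesZ⁺ x Zx = anyF-true⁺ (λ x′ → Z x′ ∧ inPart p (p x) x′) x (∧-true⁺ Zx (inPart-self x))

  red⇒touchesZʳ : ∀ a b → red a b ≡ true → touchesZ b ≡ true
  red⇒touchesZʳ a b e with red-true⁻ a b e | false⊎true (touchesZ b)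
  ... | _ | inj₂ touches = touches
  ... | x , y , x′ , y′ , refl , refl , px′ , py′ , xy , x′y′ | inj₁ untouched =
    ⊥-elim (true≢false (trans (sym xy) (trans same-adjacency x′y′)))
    where
    outside : ∀ w → p w ≡ p y → Z w ≡ false
    outside w pw with false⊎true (Z w)
    ... | inj₁ ¬Zw = ¬Zw
    ... | inj₂ Zw = ⊥-elim (true≢false (trans (sym (subst (λ c → touchesZ c ≡ true) pw (touchesZ⁺ w Zw))) untouched))
    y′≡y : y′ ≡ y
    y′≡y with y′ ≟F y
    ... | yes eq = eq
    ... | no y′≢y = ⊥-elim (true≢false (trans (sym (shared⇒inZ y′ y py′ y′≢y)) (outside y′ py′)))
    same-adjacency : adj G x y ≡ adj G x′ y′
    same-adjacency with x ≟F x′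
    ... | yes x≡x′ = cong₂ (adj G) x≡x′ (sym y′≡y)
    ... | no x≢x′ = trans (twins-outside-Z x x′ y (shared⇒inZ x x′ (sym px′) x≢x′)
                            (shared⇒inZ x′ x px′ (≢-sym x≢x′)) (sym px′) (outside y refl))
                          (cong (adj G x′) (sym y′≡y))

  red⇒touchesZˡ : ∀ a b → red a b ≡ true → touchesZ a ≡ true
  red⇒touchesZˡ a b e = red⇒touchesZʳ b a (trans (sym (red-sym a b)) e)

  red-edges-at : ∀ a → countF (λ b → before a b ∧ red a b) ≤ (if touchesZ a then M else 0)
  red-edges-at a with false⊎true (touchesZ a)
  ... | inj₂ touches rewrite touches = ≤-trans (countF-mono (λ b e → red⇒touchesZʳ a b (proj₂ (∧-true⁻ {before a b} e)))) touching≤M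
  ... | inj₁ untouched rewrite untouched = ≤-reflexive (countF-zero _ none)
    where
    none : ∀ b → (before a b ∧ red a b) ≡ false
    none b with false⊎true (before a b ∧ red a b)
    ... | inj₁ ¬e = ¬e
    ... | inj₂ e = ⊥-elim (true≢false (trans (sym (red⇒touchesZˡ a b (proj₂ (∧-true⁻ {before a b} e)))) untouched))

  nontrivial⇒touchesZ : ∀ a → nontrivial a ≡ true → touchesZ a ≡ true
  nontrivial⇒touchesZ a e with countF≥1⇒witness (inPart p a) (≤-trans (s≤s z≤n) (≤ᵇ-true⁻ e))
  ... | x , x∈a with countF≥2⇒other (inPart p a) x (≤ᵇ-true⁻ e)
  ... | w , w≢x , w∈a = subst (λ c → touchesZ c ≡ true) (⌊⌋-true⁻ (p x ≟F a) x∈a)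
          (touchesZ⁺ x (shared⇒inZ x w (trans (⌊⌋-true⁻ (p x ≟F a) x∈a) (sym (⌊⌋-true⁻ (p w ≟F a) w∈a))) (≢-sym w≢x)))

  redCount≤ : redCount G p ≤ M * M + M
  redCount≤ = +-mono-≤ (≤-trans (sumF≤countF* _ touchesZ M red-edges-at) (*-mono-≤ touching≤M (≤-refl {M})))
                       (≤-trans (countF-mono nontrivial⇒touchesZ) touching≤M)

module DownwardClosed {N : ℕ} (f : Fin N → Bool) (down : ∀ i i′ → toℕ i′ ≤ toℕ i → f i ≡ true → f i′ ≡ true) where

  true⇒<countF : ∀ i → f i ≡ true → toℕ i < countF f
  true⇒<countF i fᵢ = ≤-trans (≤-reflexive (sym (countF-<ᵇ N (suc (toℕ i)) (toℕ<n i))))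
                        (countF-mono (λ i′ e → down i i′ (≤-pred (<ᵇ-true⁻ e)) fᵢ))

  <countF⇒true : ∀ i → toℕ i < countF f → f i ≡ true
  <countF⇒true i lt with false⊎true (f i)
  ... | inj₂ e = e
  ... | inj₁ e = ⊥-elim (<-irrefl refl (<-≤-trans lt (≤-trans (countF-mono below) (≤-reflexive (countF-<ᵇ N (toℕ i) (<⇒≤ (toℕ<n i)))))))
    where
    below : ∀ i′ → f i′ ≡ true → (toℕ i′ <ᵇ toℕ i) ≡ true
    below i′ e′ with toℕ i ≤? toℕ i′
    ... | yes le = ⊥-elim (true≢false (trans (sym (down i′ i le e′)) e))
    ... | no nle = <ᵇ-true⁺ (≰⇒> nle)

argmin : ∀ {N} (f : Fin N → Bool) (μ : Fin N → ℕ) → ∀ x → f x ≡ true →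
         ∃ λ v → f v ≡ true × (∀ u → f u ≡ true → μ v ≤ μ u)
argmin {suc N} f μ x fx with false⊎true (anyF (f ∘ suc))
argmin {suc N} f μ x fx | inj₁ e = zero , only-zero x fx , minimal
  where
  only-zero : ∀ y → f y ≡ true → f zero ≡ true
  only-zero zero fy = fy
  only-zero (suc y) fy = ⊥-elim (true≢false (trans (sym fy) (anyF-false⁻ _ e y)))
  minimal : ∀ u → f u ≡ true → μ zero ≤ μ u
  minimal zero _ = ≤-refl
  minimal (suc u) fu = ⊥-elim (true≢false (trans (sym fu) (anyF-false⁻ _ e u)))
argmin {suc N} f μ x fx | inj₂ e with anyF-true⁻ _ e
... | x′ , fx′ with argmin (f ∘ suc) (μ ∘ suc) x′ fx′
... | v , fv , min-v with f zero in f₀ | μ zero ≤? μ (suc v)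
... | true | yes le = zero , f₀ , minimal
  where
  minimal : ∀ u → f u ≡ true → μ zero ≤ μ u
  minimal zero _ = ≤-refl
  minimal (suc u) fu = ≤-trans le (min-v u fu)
... | true | no nle = suc v , fv , minimal
  where
  minimal : ∀ u → f u ≡ true → μ (suc v) ≤ μ u
  minimal zero _ = <⇒≤ (≰⇒> nle)
  minimal (suc u) fu = min-v u fu
... | false | _ = suc v , fv , minimal
  where
  minimal : ∀ u → f u ≡ true → μ (suc v) ≤ μ u
  minimal zero fu = ⊥-elim (true≢false (trans (sym fu) f₀))
  minimal (suc u) fu = min-v u fu

module RankByKey {N : ℕ} (key : Fin N → ℕ) where

  _≺_ : Fin N → Fin N → Set
  u ≺ v = key v < key u ⊎ (key u ≡ key v × toℕ u < toℕ v)

  _≺?_ : ∀ u v → Dec (u ≺ v)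
  u ≺? v = (key v <? key u) ⊎-dec ((key u ≟ key v) ×-dec (toℕ u <? toℕ v))

  ≺-irrefl : ∀ v → ¬ v ≺ v
  ≺-irrefl v (inj₁ l) = <-irrefl refl l
  ≺-irrefl v (inj₂ (_ , l)) = <-irrefl refl l

  ≺-trans : ∀ {u v w} → u ≺ v → v ≺ w → u ≺ w
  ≺-trans (inj₁ a) (inj₁ b) = inj₁ (<-trans b a)
  ≺-trans {u} (inj₁ a) (inj₂ (e , _)) = inj₁ (subst (_< key u) e a)
  ≺-trans {w = w} (inj₂ (e , _)) (inj₁ b) = inj₁ (subst (key w <_) (sym e) b)
  ≺-trans (inj₂ (e₁ , l₁)) (inj₂ (e₂ , l₂)) = inj₂ (trans e₁ e₂ , <-trans l₁ l₂)

  ≺-total : ∀ u v → ¬ u ≡ v → u ≺ v ⊎ v ≺ u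
  ≺-total u v u≢v with <-cmp (key u) (key v)
  ... | tri< l _ _ = inj₂ (inj₁ l)
  ... | tri> _ _ g = inj₁ (inj₁ g)
  ... | tri≈ _ e _ with <-cmp (toℕ u) (toℕ v)
  ...   | tri< l _ _ = inj₁ (inj₂ (e , l))
  ...   | tri> _ _ g = inj₂ (inj₂ (sym e , g))
  ...   | tri≈ _ e′ _ = ⊥-elim (u≢v (toℕ-injective e′))

  rankℕ : Fin N → ℕ
  rankℕ v = countF (λ u → ⌊ u ≺? v ⌋)

  rankℕ-strict : ∀ {u v} → u ≺ v → rankℕ u < rankℕ v
  rankℕ-strict {u} {v} u≺v = countF-strict (λ w e → ⌊⌋-true⁺ (w ≺? v) (≺-trans (⌊⌋-true⁻ (w ≺? u) e) u≺v)) u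
    (⌊⌋-false⁺ (u ≺? u) (≺-irrefl u)) (⌊⌋-true⁺ (u ≺? v) u≺v)

  rankℕ<N : ∀ v → rankℕ v < N
  rankℕ<N v = <-≤-trans (countF-strict {f = λ u → ⌊ u ≺? v ⌋} {g = λ _ → true} (λ _ _ → refl) v
                                       (⌊⌋-false⁺ (v ≺? v) (≺-irrefl v)) refl)
                        (≤-reflexive (countF-true N))

  rank : Fin N → Fin N
  rank v = fromℕ< (rankℕ<N v)

  toℕ-rank : ∀ v → toℕ (rank v) ≡ rankℕ v
  toℕ-rank v = toℕ-fromℕ< (rankℕ<N v)

  rank-injective : ∀ {u v} → rank u ≡ rank v → u ≡ v
  rank-injective {u} {v} eq with u ≟F v
  ... | yes u≡v = u≡v
  ... | no u≢v with ≺-total u v u≢v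
  ...   | inj₁ u≺v = ⊥-elim (<-irrefl same-rank (rankℕ-strict u≺v))
    where same-rank = trans (sym (toℕ-rank u)) (trans (cong toℕ eq) (toℕ-rank v))
  ...   | inj₂ v≺u = ⊥-elim (<-irrefl (sym same-rank) (rankℕ-strict v≺u))
    where same-rank = trans (sym (toℕ-rank u)) (trans (cong toℕ eq) (toℕ-rank v))

countF-<ᵇ-suc : ∀ {N} (f : Fin (suc N) → Bool) l r → countF (λ y → f (suc y) ∧ (toℕ y <ᵇ toℕ r)) ≡ l →
                countF (λ y → f y ∧ (toℕ y <ᵇ toℕ (suc {N} r))) ≡ indicator (f zero) + l
countF-<ᵇ-suc f l r e with f zero
... | true = cong suc e
... | false = e

countF-before : ∀ {N} (f : Fin N → Bool) l → l < countF f → ∃ λ r → f r ≡ true × countF (λ y → f y ∧ (toℕ y <ᵇ toℕ r)) ≡ l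
countF-before {suc N} f l lt with false⊎true (f zero)
countF-before {suc N} f zero lt | inj₂ f₀ = zero , f₀ , countF-zero (λ y → f y ∧ (toℕ y <ᵇ 0)) (λ y → ∧-zeroʳ (f y))
countF-before {suc N} f (suc l) lt | inj₂ f₀ with countF-before (f ∘ suc) l (≤-pred (subst (λ t → suc l < indicator t + countF (f ∘ suc)) f₀ lt))
... | r , fr , c = suc r , fr , trans (countF-<ᵇ-suc f l r c) (cong (λ t → indicator t + l) f₀)
countF-before {suc N} f l lt | inj₁ f₀ with countF-before (f ∘ suc) l (subst (λ t → l < indicator t + countF (f ∘ suc)) f₀ lt)
... | r , fr , c = suc r , fr , trans (countF-<ᵇ-suc f l r c) (cong (λ t → indicator t + l) f₀)

record BoolEquivalence (N : ℕ) : Set where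
  field
    rel : Fin N → Fin N → Bool
    rel-refl : ∀ x → rel x x ≡ true
    rel-sym : ∀ x y → rel x y ≡ true → rel y x ≡ true
    rel-trans : ∀ x y z → rel x y ≡ true → rel y z ≡ true → rel x z ≡ true

_⊆ᴱ_ : ∀ {N} → BoolEquivalence N → BoolEquivalence N → Set
E ⊆ᴱ E′ = ∀ x y → BoolEquivalence.rel E x y ≡ true → BoolEquivalence.rel E′ x y ≡ true

module Classes {N : ℕ} (E : BoolEquivalence N) where
  open BoolEquivalence E

  private
    least-related : ∀ x → ∃ λ v → rel x v ≡ true × (∀ u → rel x u ≡ true → toℕ v ≤ toℕ u)
    least-related x = argmin (rel x) toℕ x (rel-refl x)

  rep : Fin N → Fin N
  rep x = proj₁ (least-related x)

  rel-rep : ∀ x → rel x (rep x) ≡ true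
  rel-rep x = proj₁ (proj₂ (least-related x))

  rep-minimal : ∀ x u → rel x u ≡ true → toℕ (rep x) ≤ toℕ u
  rep-minimal x = proj₂ (proj₂ (least-related x))

  rep-cong : ∀ x y → rel x y ≡ true → rep x ≡ rep y
  rep-cong x y e = toℕ-injective (≤-antisym
    (rep-minimal x (rep y) (rel-trans x y (rep y) e (rel-rep y)))
    (rep-minimal y (rep x) (rel-trans y x (rep x) (rel-sym x y e) (rel-rep x))))

  rep-injective : ∀ x y → rep x ≡ rep y → rel x y ≡ true
  rep-injective x y e = rel-trans x (rep x) y (rel-rep x) (rel-sym y (rep x) (subst (λ t → rel y t ≡ true) (sym e) (rel-rep y)))

  isRep : Fin N → Bool
  isRep x = ⌊ rep x ≟F x ⌋

  isRep-rep : ∀ x → isRep (rep x) ≡ true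
  isRep-rep x = ⌊⌋-true⁺ (rep (rep x) ≟F rep x) (sym (rep-cong x (rep x) (rel-rep x)))

  isRep⇒minimal : ∀ r → isRep r ≡ true → ∀ u → rel r u ≡ true → toℕ r ≤ toℕ u
  isRep⇒minimal r e u ru = subst (λ t → toℕ t ≤ toℕ u) (⌊⌋-true⁻ (rep r ≟F r) e) (rep-minimal r u ru)

  minimal⇒isRep : ∀ r → (∀ u → rel r u ≡ true → toℕ r ≤ toℕ u) → isRep r ≡ true
  minimal⇒isRep r h = ⌊⌋-true⁺ (rep r ≟F r) (toℕ-injective (≤-antisym (rep-minimal r r (rel-refl r)) (h (rep r) (rel-rep r))))

  classCount : ℕ
  classCount = countF isRep

  labelℕ : Fin N → ℕ
  labelℕ x = countF (λ y → isRep y ∧ (toℕ y <ᵇ toℕ (rep x)))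

  private
    not-before-self : ∀ x → isRep (rep x) ∧ (toℕ (rep x) <ᵇ toℕ (rep x)) ≡ false
    not-before-self x = trans (cong (isRep (rep x) ∧_) (<ᵇ-false⁺ {toℕ (rep x)} (<-irrefl refl))) (∧-zeroʳ _)

  labelℕ<classCount : ∀ x → labelℕ x < classCount
  labelℕ<classCount x = countF-strict (λ y e → proj₁ (∧-true⁻ {isRep y} e)) (rep x) (not-before-self x) (isRep-rep x)

  labelℕ-cong : ∀ x y → rel x y ≡ true → labelℕ x ≡ labelℕ y
  labelℕ-cong x y e = cong (λ r → countF (λ z → isRep z ∧ (toℕ z <ᵇ toℕ r))) (rep-cong x y e)

  labelℕ-strict : ∀ x y → toℕ (rep x) < toℕ (rep y) → labelℕ x < labelℕ y
  labelℕ-strict x y l = countF-strict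
    (λ z e → let (a , b) = ∧-true⁻ {isRep z} e in ∧-true⁺ a (<ᵇ-true⁺ (<-trans (<ᵇ-true⁻ b) l))) (rep x)
    (not-before-self x) (∧-true⁺ (isRep-rep x) (<ᵇ-true⁺ l))

  labelℕ-injective : ∀ x y → labelℕ x ≡ labelℕ y → rel x y ≡ true
  labelℕ-injective x y e with <-cmp (toℕ (rep x)) (toℕ (rep y))
  ... | tri< l _ _ = ⊥-elim (<-irrefl e (labelℕ-strict x y l))
  ... | tri> _ _ g = ⊥-elim (<-irrefl (sym e) (labelℕ-strict y x g))
  ... | tri≈ _ q _ = rep-injective x y (toℕ-injective q)

  total⇒classCount≤1 : (∀ x y → rel x y ≡ true) → classCount ≤ 1
  total⇒classCount≤1 total = countF≤1 isRep (λ x y x-rep y-rep →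
    toℕ-injective (≤-antisym (isRep⇒minimal x x-rep y (total x y)) (isRep⇒minimal y y-rep x (total y x))))

  labelℕ-surjective : ∀ l → l < classCount → ∃ λ x → labelℕ x ≡ l
  labelℕ-surjective l lt with countF-before isRep l lt
  ... | r , r-isRep , c = r , trans (cong (λ t → countF (λ z → isRep z ∧ (toℕ z <ᵇ toℕ t))) (⌊⌋-true⁻ (rep r ≟F r) r-isRep)) c

module _ {N : ℕ} (E E′ : BoolEquivalence N) where
  private
    module C = Classes E
    module C′ = Classes E′

  rep-ext : (∀ x y → BoolEquivalence.rel E x y ≡ BoolEquivalence.rel E′ x y) → ∀ x → C.rep x ≡ C′.rep x
  rep-ext h x = toℕ-injective (≤-antisym
    (C.rep-minimal x (C′.rep x) (trans (h x (C′.rep x)) (C′.rel-rep x)))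
    (C′.rep-minimal x (C.rep x) (trans (sym (h x (C.rep x))) (C.rel-rep x))))

  classCount-ext : (∀ x y → BoolEquivalence.rel E x y ≡ BoolEquivalence.rel E′ x y) → C.classCount ≡ C′.classCount
  classCount-ext h = countF-cong (λ x → cong (λ r → ⌊ r ≟F x ⌋) (rep-ext h x))

  isRep-coarser⇒isRep : E ⊆ᴱ E′ → ∀ r → C′.isRep r ≡ true → C.isRep r ≡ true
  isRep-coarser⇒isRep E⊆E′ r e = C.minimal⇒isRep r (λ u ru → C′.isRep⇒minimal r e u (E⊆E′ r u ru))

Fin1-equal : ∀ (a b : Fin 1) → a ≡ b
Fin1-equal zero zero = refl

module TotalTwinWidth⇒LinearBooleanWidth (G : Graph) (k : ℕ) (S : PartitionSeq G)
  (few : ∀ j → j < n G → redCount G (proj₁ S j) ≤ k) where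

  N = n G
  P = proj₁ S
  P-surjective = proj₁ (proj₂ S)
  P-refines = proj₂ (proj₂ S)

  nontrivialAt : ℕ → Fin N → Bool
  nontrivialAt j v = 2 ≤ᵇ countF (inPart (P j) (P j v))

  nontrivialAt-suc : ∀ j v → suc j < N → nontrivialAt (suc j) v ≡ true → nontrivialAt j v ≡ true
  nontrivialAt-suc j v lt e = ≤ᵇ-true⁺ (≤-trans (≤ᵇ-true⁻ e) (countF-mono (λ x ex →
    ⌊⌋-true⁺ (P j x ≟F P j v) (P-refines j lt x v (⌊⌋-true⁻ (P (suc j) x ≟F P (suc j) v) ex)))))

  nontrivialAt-+ : ∀ d j v → j + d < N → nontrivialAt (j + d) v ≡ true → nontrivialAt j v ≡ true
  nontrivialAt-+ zero j v lt e = subst (λ t → nontrivialAt t v ≡ true) (+-identityʳ j) e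
  nontrivialAt-+ (suc d) j v lt e = nontrivialAt-+ d j v (<-trans (n<1+n (j + d)) lt′) (nontrivialAt-suc (j + d) v lt′ e′)
    where
    lt′ : suc (j + d) < N
    lt′ = subst (_< N) (+-suc j d) lt
    e′ : nontrivialAt (suc (j + d)) v ≡ true
    e′ = subst (λ t → nontrivialAt t v ≡ true) (+-suc j d) e

  nontrivialAt-≤ : ∀ v (i i′ : Fin N) → toℕ i′ ≤ toℕ i → nontrivialAt (toℕ i) v ≡ true → nontrivialAt (toℕ i′) v ≡ true
  nontrivialAt-≤ v i i′ le e = nontrivialAt-+ (toℕ i ∸ toℕ i′) (toℕ i′) v
    (subst (_< N) (sym (m+[n∸m]≡n le)) (toℕ<n i)) (subst (λ t → nontrivialAt t v ≡ true) (sym (m+[n∸m]≡n le)) e)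

  -- P j has j + 1 parts and gets coarser as j decreases, so v lies in a nontrivial part of P j
  -- exactly for j < lifetime v.
  lifetime : Fin N → ℕ
  lifetime v = countF (λ (i : Fin N) → nontrivialAt (toℕ i) v)

  module Lifetime (v : Fin N) = DownwardClosed (λ (i : Fin N) → nontrivialAt (toℕ i) v) (nontrivialAt-≤ v)

  nontrivialAt⇒<lifetime : ∀ j v → (lt : j < N) → nontrivialAt j v ≡ true → j < lifetime v
  nontrivialAt⇒<lifetime j v lt e = subst (_< lifetime v) (toℕ-fromℕ< lt)
    (Lifetime.true⇒<countF v (fromℕ< lt) (subst (λ t → nontrivialAt t v ≡ true) (sym (toℕ-fromℕ< lt)) e))

  <lifetime⇒nontrivialAt : ∀ j v → (lt : j < N) → j < lifetime v → nontrivialAt j v ≡ true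
  <lifetime⇒nontrivialAt j v lt l = subst (λ t → nontrivialAt t v ≡ true) (toℕ-fromℕ< lt)
    (Lifetime.<countF⇒true v (fromℕ< lt) (subst (_< lifetime v) (sym (toℕ-fromℕ< lt)) l))

  parts≤imageSize : ∀ j → j < N → ∀ {M} (g : Fin M → Fin (suc j)) → (∀ x → ∃ λ a → g a ≡ P j x) → suc j ≤ imageSize _≟F_ g
  parts≤imageSize j lt g covers = injection-into-image⇒≤imageSize _≟F_ g id
    (λ b → let (x , Px≡b) = P-surjective j lt b ; (a , ga) = covers x in a , trans ga (Px≡b refl)) (λ a b e → e)

  lifetime<N : ∀ v → lifetime v < N
  lifetime<N v with lifetime v <? N
  ... | yes l = l
  ... | no nl = ⊥-elim (<-irrefl refl (<-≤-trans (collision⇒imageSize< _≟F_ (P N′) v w (≢-sym w≢v) (sym Pw≡Pv)) N≤image))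
    where
    N′ = N ∸ 1
    N′+1≡N : suc N′ ≡ N
    N′+1≡N = m+[n∸m]≡n (<-≤-trans (s≤s z≤n) (toℕ<n v))
    N′<N : N′ < N
    N′<N = ≤-reflexive N′+1≡N
    nontrivial-last : nontrivialAt N′ v ≡ true
    nontrivial-last = <lifetime⇒nontrivialAt N′ v N′<N (<-≤-trans N′<N (≮⇒≥ nl))
    other = countF≥2⇒other (inPart (P N′) (P N′ v)) v (≤ᵇ-true⁻ nontrivial-last)
    w = proj₁ other
    w≢v = proj₁ (proj₂ other)
    Pw≡Pv : P N′ w ≡ P N′ v
    Pw≡Pv = ⌊⌋-true⁻ (P N′ w ≟F P N′ v) (proj₂ (proj₂ other))
    N≤image : N ≤ imageSize _≟F_ (P N′)
    N≤image = subst (_≤ imageSize _≟F_ (P N′)) N′+1≡N (parts≤imageSize N′ N′<N (P N′) (λ x → x , refl))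

  lifetime>0 : 2 ≤ N → ∀ v → 0 < lifetime v
  lifetime>0 2≤N v = nontrivialAt⇒<lifetime 0 v (<-≤-trans (s≤s z≤n) 2≤N)
    (≤ᵇ-true⁺ (≤-trans 2≤N (≤-trans (≤-reflexive (sym (countF-true N)))
      (countF-mono (λ x _ → ⌊⌋-true⁺ (P 0 x ≟F P 0 v) (Fin1-equal _ _))))))

  newlyMerged : ℕ → Fin N → Bool
  newlyMerged j v = nontrivialAt j v ∧ not (nontrivialAt (suc j) v)

  newlyMerged≤2 : ∀ j → suc j < N → countF (newlyMerged j) ≤ 2
  newlyMerged≤2 j lt with 3 ≤? countF (newlyMerged j)
  ... | no ¬3≤ = ≤-pred (≰⇒> ¬3≤)
  ... | yes 3≤ = ⊥-elim (three-newly-merged (countF≥3⇒three (newlyMerged j) 3≤))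
    where
    fine = P (suc j)
    coarse = P j
    open PartitionFacts G fine using (trivial⇒singleton)
    coarsen : Fin (suc (suc j)) → Fin (suc j)
    coarsen a = coarse (proj₁ (P-surjective (suc j) lt a))
    coarsen-fine : ∀ x → coarsen (fine x) ≡ coarse x
    coarsen-fine x = P-refines j lt _ x (proj₂ (P-surjective (suc j) lt (fine x)) refl)
    j+1≤image : suc j ≤ imageSize _≟F_ coarsen
    j+1≤image = parts≤imageSize j (<-trans (n<1+n j) lt) coarsen (λ x → fine x , coarsen-fine x)
    singleton-in-fine : ∀ u → newlyMerged j u ≡ true → nontrivialAt (suc j) u ≡ false
    singleton-in-fine u e = not≡true⇒false (proj₂ (∧-true⁻ {nontrivialAt j u} e))
    distinct-fine-parts : ∀ u u′ → newlyMerged j u′ ≡ true → ¬ u ≡ u′ → ¬ fine u ≡ fine u′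
    distinct-fine-parts u u′ e′ u≢u′ eq = u≢u′ (trivial⇒singleton u′ u (singleton-in-fine u′ e′) (⌊⌋-true⁺ (fine u ≟F fine u′) eq))
    partner : ∀ u → newlyMerged j u ≡ true → Σ (Fin N) λ w → ¬ fine w ≡ fine u × coarsen (fine w) ≡ coarsen (fine u)
    partner u e with countF≥2⇒other (inPart coarse (coarse u)) u (≤ᵇ-true⁻ (proj₁ (∧-true⁻ {nontrivialAt j u} e)))
    ... | w , w≢u , w~u = w , (λ eq → w≢u (trivial⇒singleton u w (singleton-in-fine u e) (⌊⌋-true⁺ (fine w ≟F fine u) eq))) ,
                          trans (coarsen-fine w) (trans (⌊⌋-true⁻ (coarse w ≟F coarse u) w~u) (sym (coarsen-fine u)))
    three-newly-merged : (∃ λ u₁ → ∃ λ u₂ → ∃ λ u₃ → newlyMerged j u₁ ≡ true × newlyMerged j u₂ ≡ true × newlyMerged j u₃ ≡ true ×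
                          ¬ u₁ ≡ u₂ × ¬ u₁ ≡ u₃ × ¬ u₂ ≡ u₃) → ⊥
    three-newly-merged (u₁ , u₂ , u₃ , e₁ , e₂ , e₃ , u₁≢u₂ , u₁≢u₃ , u₂≢u₃)
      with partner u₁ e₁ | partner u₂ e₂ | partner u₃ e₃
    ... | w₁ , f₁ , c₁ | w₂ , f₂ , c₂ | w₃ , f₃ , c₃ = <-irrefl refl (<-≤-trans (≤-pred too-small) j+1≤image)
      where
      too-small : suc (imageSize _≟F_ coarsen) < suc (suc j)
      too-small = three-colliding⇒suc-imageSize< _≟F_ coarsen (fine u₁) (fine u₂) (fine u₃) (fine w₁) (fine w₂) (fine w₃)
        (distinct-fine-parts u₁ u₂ e₂ u₁≢u₂) (distinct-fine-parts u₁ u₃ e₃ u₁≢u₃) (distinct-fine-parts u₂ u₃ e₃ u₂≢u₃)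
        f₁ f₂ f₃ c₁ c₂ c₃

  open RankByKey lifetime

  Prefix : ℕ → VSet N
  Prefix i = prefixSet rank i

  ∈Prefix⁻ : ∀ i v → lookup (Prefix i) v ≡ true → rankℕ v < i
  ∈Prefix⁻ i v e = subst (_≤ i) (cong suc (toℕ-rank v)) (≤ᵇ-true⁻ (trans (sym (lookup∘tabulate _ v)) e))

  ∈Prefix⁺ : ∀ i v → rankℕ v < i → lookup (Prefix i) v ≡ true
  ∈Prefix⁺ i v l = trans (lookup∘tabulate _ v) (≤ᵇ-true⁺ (subst (_≤ i) (cong suc (sym (toℕ-rank v))) l))

  rank-zero : Fin N → Σ (Fin N) λ v₀ → rankℕ v₀ ≡ 0
  rank-zero x = v₀ , countF-zero _ (λ u → ⌊⌋-false⁺ (u ≺? v₀)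
                                       (λ u≺v₀ → <-irrefl refl (<-≤-trans (rankℕ-strict u≺v₀) (minimal u refl))))
    where
    v₀ = proj₁ (argmin (λ _ → true) rankℕ x refl)
    minimal = proj₂ (proj₂ (argmin (λ _ → true) rankℕ x refl))

  K = k + k + k + 2

  -- suc θ is the least lifetime in the prefix: vertices living longer come earlier in the order, so
  -- the prefix is Merged at level suc θ plus vertices that were merged exactly at level θ.
  prefix-cut-from-minimum : ∀ i → 1 ≤ i → i < N → ∀ (v* : Fin N) → lookup (Prefix i) v* ≡ true →
                            (∀ v → lookup (Prefix i) v ≡ true → lifetime v* ≤ lifetime v) → cutBool≤ G (Prefix i) K
  prefix-cut-from-minimum i 1≤i i<N v* v*∈X minimal =
    cutBool≤-extend G Merged X (k + k + k) 2 Merged⊆X extra≤2 (FewRedEdges.Merged-cut G k (P (suc θ)) (few (suc θ) θ+1<N))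
    where
    X = Prefix i
    θ = lifetime v* ∸ 1
    θ+1≡ : suc θ ≡ lifetime v*
    θ+1≡ = m+[n∸m]≡n (lifetime>0 (<-≤-trans (s≤s 1≤i) i<N) v*)
    θ+1<N : suc θ < N
    θ+1<N = subst (_< N) (sym θ+1≡) (lifetime<N v*)
    open FewRedEdges G k (P (suc θ)) (few (suc θ) θ+1<N) using (Merged)
    Merged⊆X : Merged ⊆ᵛ X
    Merged⊆X u e = ∈Prefix⁺ i u (<-trans (rankℕ-strict (inj₁ v*<u)) (∈Prefix⁻ i v* v*∈X))
      where
      v*<u : lifetime v* < lifetime u
      v*<u = subst (_< lifetime u) θ+1≡ (nontrivialAt⇒<lifetime (suc θ) u θ+1<N (trans (sym (lookup∘tabulate _ u)) e))
    extra⊆newlyMerged : ∀ v → lookup (X ∖ᵛ Merged) v ≡ true → newlyMerged θ v ≡ true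
    extra⊆newlyMerged v e with ∧-true⁻ {lookup X v} (trans (sym (lookup∘tabulate _ v)) e)
    ... | v∈X , v∉Merged = ∧-true⁺
      (<lifetime⇒nontrivialAt θ v (<-trans (n<1+n θ) θ+1<N) (subst (_≤ lifetime v) (sym θ+1≡) (minimal v v∈X)))
      (cong not (trans (sym (lookup∘tabulate _ v)) (not≡true⇒false v∉Merged)))
    extra≤2 : size (X ∖ᵛ Merged) ≤ 2
    extra≤2 = ≤-trans (countF-mono extra⊆newlyMerged) (newlyMerged≤2 θ θ+1<N)

  prefix-cut : ∀ i → 1 ≤ i → i < N → cutBool≤ G (Prefix i) K
  prefix-cut i 1≤i i<N = prefix-cut-from-minimum i 1≤i i<N (proj₁ minimum) (proj₁ (proj₂ minimum)) (proj₂ (proj₂ minimum))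
    where
    first = rank-zero (fromℕ< (<-≤-trans (s≤s z≤n) i<N))
    minimum = argmin (lookup (Prefix i)) lifetime (proj₁ first) (∈Prefix⁺ i (proj₁ first) (subst (_< i) (sym (proj₂ first)) 1≤i))

  linearBooleanWidth≤ : lboolw≤ G K
  linearBooleanWidth≤ = (rank , rank-injective) , (λ v → singleton-cut G v K (≤-trans (s≤s z≤n) (m≤n+m 2 (k + k + k)))) , prefix-cut

module LinearBooleanWidth⇒TotalTwinWidth (G : Graph) (k : ℕ) (L : LinearDecomp G) (W : decompWidth≤ G L k) where

  N = n G
  pos = proj₁ L

  pos-injective : ∀ {x y} → pos x ≡ pos y → x ≡ y
  pos-injective = proj₂ L

  inPrefix : ℕ → Fin N → Bool
  inPrefix i v = suc (toℕ (pos v)) ≤ᵇ i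

  inPrefix-suc : ∀ i v → inPrefix i v ≡ true → inPrefix (suc i) v ≡ true
  inPrefix-suc i v e = ≤ᵇ-true⁺ (≤-trans (≤ᵇ-true⁻ e) (n≤1+n i))

  TwinsOutside : ℕ → Fin N → Fin N → Set
  TwinsOutside i x y = ∀ z → inPrefix i z ≡ false → adj G x z ≡ adj G y z

  twinsOutside : ℕ → Fin N → Fin N → Bool
  twinsOutside i x y = not (anyF (λ z → not (inPrefix i z) ∧ not ⌊ adj G x z ≟𝔹 adj G y z ⌋))

  twinsOutside-true⁻ : ∀ i x y → twinsOutside i x y ≡ true → TwinsOutside i x y
  twinsOutside-true⁻ i x y e z z∉ = ⌊⌋-true⁻ (adj G x z ≟𝔹 adj G y z) (not-false⇒true
    (subst (λ t → (not t ∧ not ⌊ adj G x z ≟𝔹 adj G y z ⌋) ≡ false) z∉ (anyF-false⁻ _ (not≡true⇒false e) z)))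
    where
    not-false⇒true : ∀ {b} → not b ≡ false → b ≡ true
    not-false⇒true {true} _ = refl

  twinsOutside-true⁺ : ∀ i x y → TwinsOutside i x y → twinsOutside i x y ≡ true
  twinsOutside-true⁺ i x y twins = false⇒not≡true (anyF-false⁺ _ agree)
    where
    agree : ∀ z → (not (inPrefix i z) ∧ not ⌊ adj G x z ≟𝔹 adj G y z ⌋) ≡ false
    agree z with inPrefix i z in e
    ... | true = refl
    ... | false = cong not (⌊⌋-true⁺ (adj G x z ≟𝔹 adj G y z) (twins z e))

  sameClassᵇ : ℕ → Fin N → Fin N → Bool
  sameClassᵇ i x y = ⌊ x ≟F y ⌋ ∨ (inPrefix i x ∧ inPrefix i y ∧ twinsOutside i x y)

  sameClass⁻ : ∀ i x y → sameClassᵇ i x y ≡ true → x ≡ y ⊎ (inPrefix i x ≡ true × inPrefix i y ≡ true × TwinsOutside i x y)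
  sameClass⁻ i x y e with ∨-true⁻ {⌊ x ≟F y ⌋} e
  ... | inj₁ q = inj₁ (⌊⌋-true⁻ (x ≟F y) q)
  ... | inj₂ q with ∧-true⁻ {inPrefix i x} q
  ... | x∈ , q′ with ∧-true⁻ {inPrefix i y} q′
  ... | y∈ , tw = inj₂ (x∈ , y∈ , twinsOutside-true⁻ i x y tw)

  sameClass-≡ : ∀ i x y → x ≡ y → sameClassᵇ i x y ≡ true
  sameClass-≡ i x y x≡y = ∨-trueˡ (⌊⌋-true⁺ (x ≟F y) x≡y)

  sameClass-twins : ∀ i x y → inPrefix i x ≡ true → inPrefix i y ≡ true → TwinsOutside i x y → sameClassᵇ i x y ≡ true
  sameClass-twins i x y x∈ y∈ twins = ∨-trueʳ {⌊ x ≟F y ⌋} (∧-true⁺ x∈ (∧-true⁺ y∈ (twinsOutside-true⁺ i x y twins)))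

  SameClass : ℕ → BoolEquivalence N
  SameClass i = record { rel = sameClassᵇ i ; rel-refl = λ x → sameClass-≡ i x x refl ; rel-sym = symmetric ; rel-trans = transitive }
    where
    symmetric : ∀ x y → sameClassᵇ i x y ≡ true → sameClassᵇ i y x ≡ true
    symmetric x y e with sameClass⁻ i x y e
    ... | inj₁ x≡y = sameClass-≡ i y x (sym x≡y)
    ... | inj₂ (x∈ , y∈ , twins) = sameClass-twins i y x y∈ x∈ (λ z z∉ → sym (twins z z∉))
    transitive : ∀ x y z → sameClassᵇ i x y ≡ true → sameClassᵇ i y z ≡ true → sameClassᵇ i x z ≡ true
    transitive x y z e₁ e₂ with sameClass⁻ i x y e₁ | sameClass⁻ i y z e₂
    ... | inj₁ refl | _ = e₂
    ... | inj₂ _ | inj₁ refl = e₁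
    ... | inj₂ (x∈ , _ , t₁) | inj₂ (_ , z∈ , t₂) = sameClass-twins i x z x∈ z∈ (λ w w∉ → trans (t₁ w w∉) (t₂ w w∉))

  sameClass-suc : ∀ i x y → sameClassᵇ i x y ≡ true → sameClassᵇ (suc i) x y ≡ true
  sameClass-suc i x y e with sameClass⁻ i x y e
  ... | inj₁ x≡y = sameClass-≡ (suc i) x y x≡y
  ... | inj₂ (x∈ , y∈ , twins) = sameClass-twins (suc i) x y (inPrefix-suc i x x∈) (inPrefix-suc i y y∈) (λ z z∉ → twins z (outside z z∉))
    where
    outside : ∀ z → inPrefix (suc i) z ≡ false → inPrefix i z ≡ false
    outside z z∉ with false⊎true (inPrefix i z)
    ... | inj₁ f = f
    ... | inj₂ t = ⊥-elim (true≢false (trans (sym (inPrefix-suc i z t)) z∉))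

  classRep : ℕ → Fin N → ℕ
  classRep i x = toℕ (Classes.rep (SameClass i) x)

  classRep-cong : ∀ i x y → sameClassᵇ i x y ≡ true → classRep i x ≡ classRep i y
  classRep-cong i x y e = cong toℕ (Classes.rep-cong (SameClass i) x y e)

  -- Interpolated i 0 is SameClass i and Interpolated i N is SameClass (suc i); raising s admits the
  -- merges of SameClass (suc i) one SameClass i-representative at a time, losing at most one class.
  interpolatedᵇ : ℕ → ℕ → Fin N → Fin N → Bool
  interpolatedᵇ i s x y = sameClassᵇ i x y ∨ (sameClassᵇ (suc i) x y ∧ ((classRep i x <ᵇ s) ∧ (classRep i y <ᵇ s)))

  interpolated⁻ : ∀ i s x y → interpolatedᵇ i s x y ≡ true →
                  sameClassᵇ i x y ≡ true ⊎ (sameClassᵇ (suc i) x y ≡ true × classRep i x < s × classRep i y < s)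
  interpolated⁻ i s x y e with ∨-true⁻ {sameClassᵇ i x y} e
  ... | inj₁ q = inj₁ q
  ... | inj₂ q with ∧-true⁻ {sameClassᵇ (suc i) x y} q
  ... | q′ , r with ∧-true⁻ {classRep i x <ᵇ s} r
  ... | x< , y< = inj₂ (q′ , <ᵇ-true⁻ x< , <ᵇ-true⁻ y<)

  interpolated-old : ∀ i s x y → sameClassᵇ i x y ≡ true → interpolatedᵇ i s x y ≡ true
  interpolated-old i s x y q = ∨-trueˡ q

  interpolated-new : ∀ i s x y → sameClassᵇ (suc i) x y ≡ true → classRep i x < s → classRep i y < s → interpolatedᵇ i s x y ≡ true
  interpolated-new i s x y q x< y< = ∨-trueʳ {sameClassᵇ i x y} (∧-true⁺ q (∧-true⁺ (<ᵇ-true⁺ x<) (<ᵇ-true⁺ y<)))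

  Interpolated : ℕ → ℕ → BoolEquivalence N
  Interpolated i s = record
    { rel = interpolatedᵇ i s ; rel-refl = λ x → interpolated-old i s x x (sameClass-≡ i x x refl) ; rel-sym = symmetric ; rel-trans = transitive }
    where
    open BoolEquivalence using (rel-sym; rel-trans)
    symmetric : ∀ x y → interpolatedᵇ i s x y ≡ true → interpolatedᵇ i s y x ≡ true
    symmetric x y e with interpolated⁻ i s x y e
    ... | inj₁ q = interpolated-old i s y x (rel-sym (SameClass i) x y q)
    ... | inj₂ (q , x< , y<) = interpolated-new i s y x (rel-sym (SameClass (suc i)) x y q) y< x<
    transitive : ∀ x y z → interpolatedᵇ i s x y ≡ true → interpolatedᵇ i s y z ≡ true → interpolatedᵇ i s x z ≡ true
    transitive x y z e₁ e₂ with interpolated⁻ i s x y e₁ | interpolated⁻ i s y z e₂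
    ... | inj₁ q₁ | inj₁ q₂ = interpolated-old i s x z (rel-trans (SameClass i) x y z q₁ q₂)
    ... | inj₁ q₁ | inj₂ (q₂ , y< , z<) = interpolated-new i s x z (rel-trans (SameClass (suc i)) x y z (sameClass-suc i x y q₁) q₂)
                                            (subst (_< s) (sym (classRep-cong i x y q₁)) y<) z<
    ... | inj₂ (q₁ , x< , y<) | inj₁ q₂ = interpolated-new i s x z (rel-trans (SameClass (suc i)) x y z q₁ (sameClass-suc i y z q₂))
                                            x< (subst (_< s) (classRep-cong i y z q₂) y<)
    ... | inj₂ (q₁ , x< , _) | inj₂ (q₂ , _ , z<) = interpolated-new i s x z (rel-trans (SameClass (suc i)) x y z q₁ q₂) x< z<

  interpolated⇒sameClass-suc : ∀ i s x y → interpolatedᵇ i s x y ≡ true → sameClassᵇ (suc i) x y ≡ true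
  interpolated⇒sameClass-suc i s x y e with interpolated⁻ i s x y e
  ... | inj₁ q = sameClass-suc i x y q
  ... | inj₂ (q , _ , _) = q

  interpolated-suc : ∀ i s → Interpolated i s ⊆ᴱ Interpolated i (suc s)
  interpolated-suc i s x y e with interpolated⁻ i s x y e
  ... | inj₁ q = interpolated-old i (suc s) x y q
  ... | inj₂ (q , x< , y<) = interpolated-new i (suc s) x y q (<-trans x< (n<1+n s)) (<-trans y< (n<1+n s))

  interpolated-end : ∀ i s → N ≤ s → ∀ x y → interpolatedᵇ i s x y ≡ interpolatedᵇ (suc i) 0 x y
  interpolated-end i s N≤s x y = bool-ext forward backward
    where
    forward : interpolatedᵇ i s x y ≡ true → interpolatedᵇ (suc i) 0 x y ≡ true
    forward e = interpolated-old (suc i) 0 x y (interpolated⇒sameClass-suc i s x y e)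
    backward : interpolatedᵇ (suc i) 0 x y ≡ true → interpolatedᵇ i s x y ≡ true
    backward e with interpolated⁻ (suc i) 0 x y e
    ... | inj₁ q = interpolated-new i s x y q (<-≤-trans (toℕ<n _) N≤s) (<-≤-trans (toℕ<n _) N≤s)
    ... | inj₂ (_ , () , _)

  module InterpolationStep (i s : ℕ) where
    private
      module Cᵢ = Classes (SameClass i)
      module C₀ = Classes (Interpolated i s)
      module C₁ = Classes (Interpolated i (suc s))

    isRep-lost⇒index≡s : ∀ r → C₀.isRep r ≡ true → C₁.isRep r ≡ false → toℕ r ≡ s
    isRep-lost⇒index≡s r r-rep₀ r-not-rep₁ = analyse (interpolated⁻ i (suc s) r y (C₁.rel-rep r))
      where
      y = C₁.rep r
      y<r : toℕ y < toℕ r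
      y<r = ≤∧≢⇒< (C₁.rep-minimal r r (BoolEquivalence.rel-refl (Interpolated i (suc s)) r))
                  (λ q → true≢false (trans (sym (⌊⌋-true⁺ (y ≟F r) (toℕ-injective q))) r-not-rep₁))
      unrelated₀ : interpolatedᵇ i s r y ≡ true → ⊥
      unrelated₀ e = <-irrefl refl (<-≤-trans y<r (C₀.isRep⇒minimal r r-rep₀ y e))
      classRep-r : classRep i r ≡ toℕ r
      classRep-r = cong toℕ (⌊⌋-true⁻ (Cᵢ.rep r ≟F r)
                     (isRep-coarser⇒isRep (SameClass i) (Interpolated i s) (interpolated-old i s) r r-rep₀))
      analyse : sameClassᵇ i r y ≡ true ⊎ (sameClassᵇ (suc i) r y ≡ true × classRep i r < suc s × classRep i y < suc s) → toℕ r ≡ s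
      analyse (inj₁ q) = ⊥-elim (unrelated₀ (interpolated-old i s r y q))
      analyse (inj₂ (q , r<s+1 , _)) with classRep i r <? s
      ... | no r≮s = trans (sym classRep-r) (≤-antisym (≤-pred r<s+1) (≮⇒≥ r≮s))
      ... | yes r<s = ⊥-elim (<-irrefl refl (<-trans (≤-<-trans s≤y y<r) (subst (_< s) classRep-r r<s)))
        where
        s≤classRep-y : s ≤ classRep i y
        s≤classRep-y = ≮⇒≥ (λ y<s → unrelated₀ (interpolated-new i s r y q r<s y<s))
        s≤y : s ≤ toℕ y
        s≤y = ≤-trans s≤classRep-y (Cᵢ.rep-minimal y y (BoolEquivalence.rel-refl (SameClass i) y))

    classCount-step : C₀.classCount ≤ suc C₁.classCount
    classCount-step = begin
      C₀.classCount                                  ≤⟨ countF-mono kept-or-s ⟩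
      countF (λ r → C₁.isRep r ∨ ⌊ toℕ r ≟ s ⌋)      ≤⟨ countF-∨ C₁.isRep (λ (r : Fin N) → ⌊ toℕ r ≟ s ⌋) ⟩
      C₁.classCount + countF (λ (r : Fin N) → ⌊ toℕ r ≟ s ⌋)   ≤⟨ +-monoʳ-≤ C₁.classCount (countF-toℕ≡ {N} s) ⟩
      C₁.classCount + 1                              ≡⟨ +-comm C₁.classCount 1 ⟩
      suc C₁.classCount                              ∎
      where
      open ≤-Reasoning
      kept-or-s : ∀ r → C₀.isRep r ≡ true → (C₁.isRep r ∨ ⌊ toℕ r ≟ s ⌋) ≡ true
      kept-or-s r e with false⊎true (C₁.isRep r)
      ... | inj₂ kept = ∨-trueˡ kept
      ... | inj₁ lost = ∨-trueʳ {C₁.isRep r} (⌊⌋-true⁺ (toℕ r ≟ s) (isRep-lost⇒index≡s r e lost))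

  next : ℕ × ℕ → ℕ × ℕ
  next (i , s) = if s <ᵇ N then (i , suc s) else (suc i , 0)

  stage : ℕ → ℕ × ℕ
  stage zero = 0 , 0
  stage (suc t) = next (stage t)

  Stage : ℕ → BoolEquivalence N
  Stage t = Interpolated (proj₁ (stage t)) (proj₂ (stage t))

  classes : ℕ → ℕ
  classes t = Classes.classCount (Stage t)

  stage-step : ∀ t → Stage t ⊆ᴱ Stage (suc t) × classes t ≤ suc (classes (suc t))
  stage-step t with stage t
  ... | i , s with s <ᵇ N in s<N
  ...   | true = interpolated-suc i s , InterpolationStep.classCount-step i s
  ...   | false = (λ x y e → trans (sym (interpolated-end i s N≤s x y)) e) ,
                  ≤-trans (≤-reflexive (classCount-ext (Interpolated i s) (Interpolated (suc i) 0) (interpolated-end i s N≤s))) (n≤1+n _)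
    where
    N≤s : N ≤ s
    N≤s = ≮⇒≥ (λ l → true≢false (trans (sym (<ᵇ-true⁺ l)) s<N))

  stage-+ : ∀ t d → Stage t ⊆ᴱ Stage (t + d)
  stage-+ t zero x y e = subst (λ u → BoolEquivalence.rel (Stage u) x y ≡ true) (sym (+-identityʳ t)) e
  stage-+ t (suc d) x y e = subst (λ u → BoolEquivalence.rel (Stage u) x y ≡ true) (sym (+-suc t d))
                              (proj₁ (stage-step (t + d)) x y (stage-+ t d x y e))

  stage-mono : ∀ t t′ → t ≤ t′ → Stage t ⊆ᴱ Stage t′
  stage-mono t t′ t≤t′ x y e = subst (λ u → BoolEquivalence.rel (Stage u) x y ≡ true) (m+[n∸m]≡n t≤t′) (stage-+ t (t′ ∸ t) x y e)

  classes-zero : classes 0 ≡ N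
  classes-zero = trans (countF-cong (λ r → Classes.minimal⇒isRep (Stage 0) r (λ u ru → ≤-reflexive (cong toℕ (discrete r u ru)))))
                       (countF-true N)
    where
    discrete : ∀ x y → interpolatedᵇ 0 0 x y ≡ true → x ≡ y
    discrete x y e with interpolated⁻ 0 0 x y e
    ... | inj₂ (_ , () , _)
    ... | inj₁ q with sameClass⁻ 0 x y q
    ...   | inj₁ x≡y = x≡y
    ...   | inj₂ (() , _)

  stage-walk : ∀ t i d → stage t ≡ (i , 0) → d ≤ N → stage (t + d) ≡ (i , d)
  stage-walk t i zero e _ = trans (cong stage (+-identityʳ t)) e
  stage-walk t i (suc d) e d<N = trans (cong stage (+-suc t d)) (trans (cong next (stage-walk t i d e (<⇒≤ d<N)))
                                   (cong (λ b → if b then (i , suc d) else (suc i , 0)) (<ᵇ-true⁺ d<N)))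

  stage-reaches : ∀ i → ∃ λ t → stage t ≡ (i , 0)
  stage-reaches zero = 0 , refl
  stage-reaches (suc i) with stage-reaches i
  ... | t , e = suc (t + N) , trans (cong next (stage-walk t i N e ≤-refl))
                  (cong (λ b → if b then (i , suc N) else (suc i , 0)) (<ᵇ-false⁺ {N} (<-irrefl refl)))

  opaque
    lastStage : ℕ
    lastStage = proj₁ (stage-reaches N)

    lastStage-total : ∀ x y → BoolEquivalence.rel (Stage lastStage) x y ≡ true
    lastStage-total x y = subst (λ p → interpolatedᵇ (proj₁ p) (proj₂ p) x y ≡ true) (sym (proj₂ (stage-reaches N)))
      (interpolated-old N 0 x y (sameClass-twins N x y (everything x) (everything y) (λ z z∉ → ⊥-elim (true≢false (trans (sym (everything z)) z∉)))))
      where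
      everything : ∀ v → inPrefix N v ≡ true
      everything v = ≤ᵇ-true⁺ (toℕ<n (pos v))

  lastStage-classes≤1 : classes lastStage ≤ 1
  lastStage-classes≤1 = Classes.total⇒classCount≤1 (Stage lastStage) lastStage-total

  firstStageWith≤ : ∀ j → ∃ λ t → classes t ≤ suc j × (∀ t′ → t′ < t → suc j < classes t′)
  firstStageWith≤ j with argmin few-classes toℕ (fromℕ< (n<1+n lastStage)) last-has-few
    where
    few-classes : Fin (suc lastStage) → Bool
    few-classes t = classes (toℕ t) ≤ᵇ suc j
    last-has-few : few-classes (fromℕ< (n<1+n lastStage)) ≡ true
    last-has-few = subst (λ t → (classes t ≤ᵇ suc j) ≡ true) (sym (toℕ-fromℕ< (n<1+n lastStage)))
                     (≤ᵇ-true⁺ (≤-trans lastStage-classes≤1 (s≤s z≤n)))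
  ... | t , t-few , minimal = toℕ t , ≤ᵇ-true⁻ t-few , earlier
    where
    earlier : ∀ t′ → t′ < toℕ t → suc j < classes t′
    earlier t′ t′<t = ≰⇒> λ t′-few → <-irrefl refl (<-≤-trans (subst (_< toℕ t) (sym (toℕ-fromℕ< t′≤last)) t′<t)
                        (minimal (fromℕ< t′≤last) (subst (λ u → (classes u ≤ᵇ suc j) ≡ true) (sym (toℕ-fromℕ< t′≤last)) (≤ᵇ-true⁺ t′-few))))
      where
      t′≤last : t′ < suc lastStage
      t′≤last = <-trans t′<t (toℕ<n t)

  -- The first stage with at most j + 1 classes has exactly j + 1, as classes drop by one at a time.
  stageFor : ℕ → ℕ
  stageFor j = proj₁ (firstStageWith≤ j)

  stageFor-few : ∀ j → classes (stageFor j) ≤ suc j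
  stageFor-few j = proj₁ (proj₂ (firstStageWith≤ j))

  before-stageFor : ∀ j t → t < stageFor j → suc j < classes t
  before-stageFor j = proj₂ (proj₂ (firstStageWith≤ j))

  classes-exact : ∀ j → j < N → ∀ t → classes t ≤ suc j → (∀ t′ → t′ < t → suc j < classes t′) → classes t ≡ suc j
  classes-exact j j<N zero few _ = ≤-antisym few (subst (suc j ≤_) (sym classes-zero) j<N)
  classes-exact j j<N (suc t) few earlier = ≤-antisym few (≤-pred (<-≤-trans (earlier t ≤-refl) (proj₂ (stage-step t))))

  classes-stageFor : ∀ j → j < N → classes (stageFor j) ≡ suc j
  classes-stageFor j j<N = classes-exact j j<N (stageFor j) (stageFor-few j) (before-stageFor j)

  stageFor-antitone : ∀ j → stageFor (suc j) ≤ stageFor j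
  stageFor-antitone j = ≮⇒≥ (λ l → <-irrefl refl (<-≤-trans (before-stageFor (suc j) (stageFor j) l) (≤-trans (stageFor-few j) (n≤1+n (suc j)))))

  partitionAt : (j : ℕ) → Fin N → Fin (suc j)
  partitionAt j x = fromℕ< (<-≤-trans (Classes.labelℕ<classCount (Stage (stageFor j)) x) (stageFor-few j))

  toℕ-partitionAt : ∀ j x → toℕ (partitionAt j x) ≡ Classes.labelℕ (Stage (stageFor j)) x
  toℕ-partitionAt j x = toℕ-fromℕ< _

  partitionAt⇒related : ∀ j x y → partitionAt j x ≡ partitionAt j y → BoolEquivalence.rel (Stage (stageFor j)) x y ≡ true
  partitionAt⇒related j x y e = Classes.labelℕ-injective (Stage (stageFor j)) x y
    (trans (sym (toℕ-partitionAt j x)) (trans (cong toℕ e) (toℕ-partitionAt j y)))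

  related⇒partitionAt : ∀ j x y → BoolEquivalence.rel (Stage (stageFor j)) x y ≡ true → partitionAt j x ≡ partitionAt j y
  related⇒partitionAt j x y r = toℕ-injective
    (trans (toℕ-partitionAt j x) (trans (Classes.labelℕ-cong (Stage (stageFor j)) x y r) (sym (toℕ-partitionAt j y))))

  partitionSequence : PartitionSeq G
  partitionSequence = partitionAt , surjective , refines
    where
    surjective : ∀ j → j < N → ∀ y → ∃ λ x → ∀ {z} → z ≡ x → partitionAt j z ≡ y
    surjective j j<N y = proj₁ labelled , λ { refl → toℕ-injective (trans (toℕ-partitionAt j (proj₁ labelled)) (proj₂ labelled)) }
      where
      labelled = Classes.labelℕ-surjective (Stage (stageFor j)) (toℕ y) (subst (toℕ y <_) (sym (classes-stageFor j j<N)) (toℕ<n y))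
    refines : ∀ j → suc j < N → ∀ x y → partitionAt (suc j) x ≡ partitionAt (suc j) y → partitionAt j x ≡ partitionAt j y
    refines j _ x y e = related⇒partitionAt j x y
      (stage-mono (stageFor (suc j)) (stageFor j) (stageFor-antitone j) x y (partitionAt⇒related (suc j) x y e))

  M : ℕ
  M = 2 ^ k + 1

  module PartitionOfStage (i s : ℕ) {m : ℕ} (p : Fin N → Fin m)
    (p⇒related : ∀ x y → p x ≡ p y → interpolatedᵇ i s x y ≡ true)
    (related⇒p : ∀ x y → interpolatedᵇ i s x y ≡ true → p x ≡ p y) where

    Z : Fin N → Bool
    Z = inPrefix (suc i)

    X Y : VSet N
    X = prefixSet pos i
    Y = compl X

    lookup-Y : ∀ z → lookup Y z ≡ not (inPrefix i z)
    lookup-Y z = trans (lookup∘tabulate (λ u → not (lookup X u)) z) (cong not (lookup∘tabulate (inPrefix i) z))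

    traceOutside : Fin N → VSet N
    traceOutside x = nbhdIn G Y (singletonSet x)

    lookup-traceOutside : ∀ x z → lookup (traceOutside x) z ≡ adj G x z ∧ not (inPrefix i z)
    lookup-traceOutside x z = trans (lookup-nbhdIn-singleton G Y x z) (cong (adj G x z ∧_) (lookup-Y z))

    shared⇒inZ : ∀ x y → p x ≡ p y → ¬ x ≡ y → Z x ≡ true
    shared⇒inZ x y e x≢y with interpolated⁻ i s x y (p⇒related x y e)
    ... | inj₁ q with sameClass⁻ i x y q
    ...   | inj₁ x≡y = ⊥-elim (x≢y x≡y)
    ...   | inj₂ (x∈ , _) = inPrefix-suc i x x∈
    shared⇒inZ x y e x≢y | inj₂ (q , _) with sameClass⁻ (suc i) x y q
    ...   | inj₁ x≡y = ⊥-elim (x≢y x≡y)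
    ...   | inj₂ (x∈ , _) = x∈

    twins-outside-Z : ∀ x x′ y → Z x ≡ true → Z x′ ≡ true → p x ≡ p x′ → Z y ≡ false → adj G x y ≡ adj G x′ y
    twins-outside-Z x x′ y _ _ e y∉ with sameClass⁻ (suc i) x x′ (interpolated⇒sameClass-suc i s x x′ (p⇒related x x′ e))
    ... | inj₁ refl = refl
    ... | inj₂ (_ , _ , twins) = twins y y∉

    position-i : ∀ x → Z x ≡ true → inPrefix i x ≡ false → toℕ (pos x) ≡ i
    position-i x x∈ x∉ = ≤-antisym (≤-pred (≤ᵇ-true⁻ x∈)) (≮⇒≥ (λ l → true≢false (trans (sym (≤ᵇ-true⁺ l)) x∉)))

    -- A vertex of Z lies either in X, where its part is determined by its trace outside X, or at
    -- position i, where it is unique.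
    signature : Fin N → VSet (suc N)
    signature x = if inPrefix i x then (true ∷ traceOutside x) else (false ∷ ∅ᵛ)

    signature-in : ∀ x → inPrefix i x ≡ true → signature x ≡ true ∷ traceOutside x
    signature-in x e rewrite e = refl

    signature-out : ∀ x → inPrefix i x ≡ false → signature x ≡ false ∷ ∅ᵛ
    signature-out x e rewrite e = refl

    head-cong : ∀ {b b′ : Bool} {v v′ : VSet N} → b ∷ v ≡ b′ ∷ v′ → b ≡ b′ × v ≡ v′
    head-cong refl = refl , refl

    signature-determines-part : ∀ {x y} → x ∈ trueIndices Z → y ∈ trueIndices Z → signature x ≡ signature y → p x ≡ p y
    signature-determines-part {x} {y} x∈ y∈ e with false⊎true (inPrefix i x) | false⊎true (inPrefix i y)
    ... | inj₂ xi | inj₂ yi = related⇒p x y (interpolated-old i s x y (sameClass-twins i x y xi yi twins))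
      where
      same-trace : traceOutside x ≡ traceOutside y
      same-trace = proj₂ (head-cong (trans (sym (signature-in x xi)) (trans e (signature-in y yi))))
      twins : TwinsOutside i x y
      twins z z∉ = begin
        adj G x z                        ≡⟨ sym (∧-identityʳ (adj G x z)) ⟩
        adj G x z ∧ true                 ≡⟨ cong (λ b → adj G x z ∧ not b) (sym z∉) ⟩
        adj G x z ∧ not (inPrefix i z)   ≡⟨ sym (lookup-traceOutside x z) ⟩
        lookup (traceOutside x) z        ≡⟨ cong (λ v → lookup v z) same-trace ⟩
        lookup (traceOutside y) z        ≡⟨ lookup-traceOutside y z ⟩
        adj G y z ∧ not (inPrefix i z)   ≡⟨ cong (λ b → adj G y z ∧ not b) z∉ ⟩
        adj G y z ∧ true                 ≡⟨ ∧-identityʳ (adj G y z) ⟩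
        adj G y z                        ∎
        where open ≡-Reasoning
    ... | inj₁ xo | inj₁ yo = cong p (pos-injective (toℕ-injective
          (trans (position-i x (∈-trueIndices⁻ Z x x∈) xo) (sym (position-i y (∈-trueIndices⁻ Z y y∈) yo)))))
    ... | inj₂ xi | inj₁ yo = ⊥-elim (true≢false (proj₁ (head-cong (trans (sym (signature-in x xi)) (trans e (signature-out y yo))))))
    ... | inj₁ xo | inj₂ yi = ⊥-elim (true≢false (sym (proj₁ (head-cong (trans (sym (signature-out x xo)) (trans e (signature-in y yi)))))))

    touchesZ : Fin m → Bool
    touchesZ a = anyF (λ x → Z x ∧ inPart p a x)

    InZ InX : List (Fin N)
    InZ = trueIndices Z
    InX = trueIndices (inPrefix i)

    touchesZ≤parts-on-Z : countF touchesZ ≤ distinctCount _≟F_ (map p InZ)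
    touchesZ≤parts-on-Z = ≤-trans (≤-reflexive (sym (length-trueIndices touchesZ)))
                                  (unique⇒length≤distinctCount _≟F_ (Unique-trueIndices touchesZ) ⊆parts)
      where
      ⊆parts : trueIndices touchesZ ⊆ map p InZ
      ⊆parts a∈ with anyF-true⁻ _ (∈-trueIndices⁻ touchesZ _ a∈)
      ... | x , ex with ∧-true⁻ {Z x} ex
      ... | Zx , x∈a = subst (_∈ map p InZ) (⌊⌋-true⁻ (p x ≟F _) x∈a) (∈-map⁺ p (∈-trueIndices⁺ Z x Zx))

    parts-on-Z≤signatures : distinctCount _≟F_ (map p InZ) ≤ distinctCount _≟ᵛ_ (map signature InZ)
    parts-on-Z≤signatures = distinctCount-factor _≟ᵛ_ signature _≟F_ p InZ signature-determines-part

    signatures≤suc-traces : distinctCount _≟ᵛ_ (map signature InZ) ≤ suc (distinctCount _≟ᵛ_ (map traceOutside InX))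
    signatures≤suc-traces = ≤-trans (distinctCount≤suc _≟ᵛ_ (false ∷ ∅ᵛ) outside-or-tagged) (s≤s untag)
      where
      outside-or-tagged : ∀ {z} → z ∈ map signature InZ → z ≡ false ∷ ∅ᵛ ⊎ z ∈ map (true ∷_) (map traceOutside InX)
      outside-or-tagged z∈ with ∈-map⁻ signature z∈
      ... | x , _ , refl with false⊎true (inPrefix i x)
      ... | inj₁ xo = inj₁ (signature-out x xo)
      ... | inj₂ xi = inj₂ (subst (_∈ map (true ∷_) (map traceOutside InX)) (sym (signature-in x xi))
                              (∈-map⁺ (true ∷_) (∈-map⁺ traceOutside (∈-trueIndices⁺ (inPrefix i) x xi))))
      untag : distinctCount _≟ᵛ_ (map (true ∷_) (map traceOutside InX)) ≤ distinctCount _≟ᵛ_ (map traceOutside InX)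
      untag = distinctCount-image _≟ᵛ_ _≟ᵛ_ (true ∷_) {xs = map (true ∷_) (map traceOutside InX)} {ys = map traceOutside InX}
        (λ z∈ → let (a , a∈ , e) = ∈-map⁻ (true ∷_) z∈ in a , a∈ , e)

    traces≤2^k : distinctCount _≟ᵛ_ (map traceOutside InX) ≤ 2 ^ k
    traces≤2^k with i ≟ 0 | i <? N
    ... | yes refl | _ = ≤-trans (distinctCount≤length _≟ᵛ_ {xs = map traceOutside InX} {ys = map traceOutside InX} id)
                           (≤-trans (≤-reflexive (trans (length-map traceOutside InX) (length-trueIndices (inPrefix 0))))
                                    (≤-trans (≤-reflexive (countF-zero (inPrefix 0) (λ v → refl))) z≤n))
    ... | no i≢0 | yes i<N = ≤-trans (distinctCount-mono _≟ᵛ_ ⊆traces) (proj₁ (proj₂ W i (n≢0⇒n>0 i≢0) i<N))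
      where
      ⊆traces : map traceOutside InX ⊆ traces G X Y
      ⊆traces z∈ with ∈-map⁻ traceOutside z∈
      ... | x , x∈ , refl = ∈-traces⁺ G {X} {Y} (singletonSet x)
            (λ u e → subst (λ w → lookup X w ≡ true) (sym (⌊⌋-true⁻ (u ≟F x) (trans (sym (lookup∘tabulate (λ w → ⌊ w ≟F x ⌋) u)) e)))
                       (trans (lookup∘tabulate (inPrefix i) x) (∈-trueIndices⁻ (inPrefix i) x x∈)))
    ... | no _ | no i≮N = ≤-trans (distinctCount≤length _≟ᵛ_ {xs = map traceOutside InX} {ys = ∅ᵛ ∷ []} all-empty) (^-monoʳ-≤ 2 (z≤n {k}))
      where
      all-empty : map traceOutside InX ⊆ (∅ᵛ ∷ [])
      all-empty z∈ with ∈-map⁻ traceOutside z∈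
      ... | x , _ , refl = here (≡∅ᵛ (traceOutside x) (λ z → trans (lookup-traceOutside x z)
                             (trans (cong (λ b → adj G x z ∧ not b) (≤ᵇ-true⁺ (≤-trans (toℕ<n (pos z)) (≮⇒≥ i≮N)))) (∧-zeroʳ (adj G x z)))))

    touchesZ≤M : countF touchesZ ≤ M
    touchesZ≤M = begin
      countF touchesZ                                           ≤⟨ touchesZ≤parts-on-Z ⟩
      distinctCount _≟F_ (map p InZ)                            ≤⟨ parts-on-Z≤signatures ⟩
      distinctCount _≟ᵛ_ (map signature InZ)                    ≤⟨ signatures≤suc-traces ⟩
      suc (distinctCount _≟ᵛ_ (map traceOutside InX))           ≤⟨ s≤s traces≤2^k ⟩
      suc (2 ^ k)                                               ≡⟨ +-comm 1 (2 ^ k) ⟩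
      M                                                         ∎
      where open ≤-Reasoning

    redCount≤ : redCount G p ≤ M * M + M
    redCount≤ = RedEdgesOfTwinPartition.redCount≤ G p Z M shared⇒inZ twins-outside-Z touchesZ≤M

  totalTwinWidth≤ : ttww≤ G (M * M + M)
  totalTwinWidth≤ = partitionSequence , λ j _ →
    PartitionOfStage.redCount≤ (proj₁ (stage (stageFor j))) (proj₂ (stage (stageFor j))) (partitionAt j)
      (partitionAt⇒related j) (related⇒partitionAt j)

ttww≤-mono : ∀ G {a b} → a ≤ b → ttww≤ G a → ttww≤ G b
ttww≤-mono G a≤b (S , few) = S , λ j j<n → ≤-trans (few j j<n) a≤b

cutBool≤-mono : ∀ G X {a b} → a ≤ b → cutBool≤ G X a → cutBool≤ G X b
cutBool≤-mono G X a≤b (out , into) = ≤-trans out (^-monoʳ-≤ 2 a≤b) , ≤-trans into (^-monoʳ-≤ 2 a≤b)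

lboolw≤-mono : ∀ G {a b} → a ≤ b → lboolw≤ G a → lboolw≤ G b
lboolw≤-mono G a≤b (L , leaves , prefixes) =
  L , (λ v → cutBool≤-mono G _ a≤b (leaves v)) , (λ i 1≤i i<n → cutBool≤-mono G _ a≤b (prefixes i 1≤i i<n))

ttwwBound lboolwBound : ℕ → ℕ
ttwwBound k = (2 ^ k + 1) * (2 ^ k + 1) + (2 ^ k + 1)
lboolwBound k = k + k + k + 2

lboolw⇒ttww : ∀ G k → lboolw≤ G k → ttww≤ G (ttwwBound k)
lboolw⇒ttww G k (L , W) = LinearBooleanWidth⇒TotalTwinWidth.totalTwinWidth≤ G k L W

ttww⇒lboolw : ∀ G k → ttww≤ G k → lboolw≤ G (lboolwBound k)
ttww⇒lboolw G k (S , few) = TotalTwinWidth⇒LinearBooleanWidth.linearBooleanWidth≤ G k S few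

theorem3p2 : Σ (ℕ → ℕ) λ f → (G : Graph) (k : ℕ) →
    (lboolw≤ G k → ttww≤ G (f k)) × (ttww≤ G k → lboolw≤ G (f k))
theorem3p2 = (λ k → ttwwBound k + lboolwBound k) , λ G k →
  (λ w → ttww≤-mono G (m≤m+n (ttwwBound k) (lboolwBound k)) (lboolw⇒ttww G k w)) ,
  (λ w → lboolw≤-mono G (m≤n+m (lboolwBound k) (ttwwBound k)) (ttww⇒lboolw G k w))
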